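{- Let $G$ be a graph and let $H$ be a subdivision of $G$. Then $|E(H)|-|V(H)|=|E(G)|-|V(G)|$. Moreover, if $H$ is $k\mathcal{C}_{\ge3}$-saturated for some $k\ge2$, then $G\cong K_{3k-1}$ or $G$ is also $k\mathcal{C}_{\ge3}$-saturated.
   Context: All graphs are finite and simple. A subdivision of $G$ is a graph obtained from $G$ by replacing the edges of $G$ with internally vertex-disjoint paths, each with at least one edge. A graph $G$ is $k\mathcal{C}_{\ge3}$-saturated if it does not contain $k$ pairwise vertex-disjoint cycles, but for every pair of non-adjacent vertices $u,v$, $G+uv$ contains $k$ pairwise vertex-disjoint cycles. -}

module Defs where

open import Data.Nat using (ℕ; zero; suc; _≤_; _<_; _*_; _∸_)
open import Data.Nat.Properties using (_<?_)
open import Data.Fin using (Fin; toℕ; _≟_)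
open import Data.Bool using (Bool; true; false; not; _∧_)
open import Data.List using (List; length; filter; allFin; cartesianProduct)
open import Data.Product using (Σ; _×_; _,_; ∃; proj₁)
open import Data.Sum using (_⊎_)
open import Data.Empty using (⊥)
open import Relation.Nullary using (¬_; Dec; yes; no)
open import Relation.Nullary.Decidable using (⌊_⌋)
open import Relation.Binary.PropositionalEquality using (_≡_; _≢_; refl; sym)
open import Function.Definitions using (Injective)
open import Data.Integer using (ℤ; +_; _-_)

record Graph : Set where
  field
    n   : ℕ
    adj : Fin n → Fin n → Bool
    adj-sym : ∀ i j → adj i j ≡ adj j i
    adj-irr : ∀ i → adj i i ≡ false
open Graph public

Edge : (G : Graph) → Fin (n G) → Fin (n G) → Set
Edge G i j = adj G i j ≡ true

∣V∣ : Graph → ℕ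
∣V∣ G = n G

∣E∣ : Graph → ℕ
∣E∣ G = length (filter (λ p → isEdge (proj₁ p) (Data.Product.proj₂ p))
                       (cartesianProduct (allFin (n G)) (allFin (n G))))
  where
  isEdge : (i j : Fin (n G)) → Dec (toℕ i < toℕ j × Edge G i j)
  isEdge i j with toℕ i <? toℕ j | adj G i j
  ... | yes p | true  = yes (p , refl)
  ... | yes p | false = no (λ { (_ , ()) })
  ... | no ¬p | _     = no (λ { (p , _) → ¬p p })

record Cycle {m : ℕ} (R : Fin m → Fin m → Set) : Set where
  field
    len   : ℕ
    len≥3 : 3 ≤ len
    vs    : Fin len → Fin m
    vs-inj : Injective _≡_ _≡_ vs
    vs-adj : ∀ (i j : Fin len) →
             (suc (toℕ i) ≡ toℕ j ⊎ (suc (toℕ i) ≡ len × toℕ j ≡ 0)) →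
             R (vs i) (vs j)
open Cycle public

HasDisjointCycles : {m : ℕ} → (Fin m → Fin m → Set) → ℕ → Set
HasDisjointCycles R k =
  Σ (Fin k → Cycle R) λ cs →
    ∀ (a b : Fin k) → a ≢ b →
    ∀ (i : Fin (len (cs a))) (j : Fin (len (cs b))) → vs (cs a) i ≢ vs (cs b) j

EdgePlus : (G : Graph) → Fin (n G) → Fin (n G) → Fin (n G) → Fin (n G) → Set
EdgePlus G u v x y = Edge G x y ⊎ ((x ≡ u × y ≡ v) ⊎ (x ≡ v × y ≡ u))

Saturated : ℕ → Graph → Set
Saturated k G =
  ¬ HasDisjointCycles (Edge G) k ×
  (∀ (u v : Fin (n G)) → u ≢ v → ¬ Edge G u v →
     HasDisjointCycles (EdgePlus G u v) k)

complete-sym : ∀ {m} (i j : Fin m) → not ⌊ i ≟ j ⌋ ≡ not ⌊ j ≟ i ⌋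
complete-sym i j with i ≟ j | j ≟ i
... | yes _ | yes _ = refl
... | no _  | no _  = refl
... | yes p | no ¬q = Data.Empty.⊥-elim (¬q (sym p))
... | no ¬p | yes q = Data.Empty.⊥-elim (¬p (sym q))

complete-irr : ∀ {m} (i : Fin m) → not ⌊ i ≟ i ⌋ ≡ false
complete-irr i with i ≟ i
... | yes _ = refl
... | no ¬p = Data.Empty.⊥-elim (¬p refl)

K : ℕ → Graph
K m = record { n = m ; adj = λ i j → not ⌊ i ≟ j ⌋
             ; adj-sym = complete-sym ; adj-irr = complete-irr }

record _≅_ (G H : Graph) : Set where
  field
    to      : Fin (n G) → Fin (n H)
    from    : Fin (n H) → Fin (n G)
    from-to : ∀ x → from (to x) ≡ x
    to-from : ∀ y → to (from y) ≡ y
    preserves : ∀ x y → adj G x y ≡ adj H (to x) (to y)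

record Path (H : Graph) (a b : Fin (n H)) : Set where
  field
    ℓ     : ℕ
    ℓ≥1   : 1 ≤ ℓ
    p     : Fin (suc ℓ) → Fin (n H)
    p-inj : Injective _≡_ _≡_ p
    p-start : ∀ i → toℕ i ≡ 0 → p i ≡ a
    p-end   : ∀ i → toℕ i ≡ ℓ → p i ≡ b
    p-adj   : ∀ (i j : Fin (suc ℓ)) → suc (toℕ i) ≡ toℕ j → Edge H (p i) (p j)
open Path public

Internal : ∀ {H a b} (P : Path H a b) → Fin (suc (ℓ P)) → Set
Internal P i = 0 < toℕ i × toℕ i < ℓ P

-- The proofs of u < v and uv ∈ E(G) are irrelevant,
-- so there is exactly one path per edge.
record SubdivisionOf (H G : Graph) : Set where
  field
    φ     : Fin (n G) → Fin (n H)
    φ-inj : Injective _≡_ _≡_ φ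
    path  : (u v : Fin (n G)) → .(toℕ u < toℕ v) → .(Edge G u v) →
            Path H (φ u) (φ v)
    internal-not-branch :
      ∀ u v .(lt : toℕ u < toℕ v) .(e : Edge G u v)
        (i : Fin (suc (ℓ (path u v lt e)))) →
      Internal (path u v lt e) i → ∀ w → p (path u v lt e) i ≢ φ w
    internally-disjoint :
      ∀ u v .(lt : toℕ u < toℕ v) .(e : Edge G u v)
        u' v' .(lt' : toℕ u' < toℕ v') .(e' : Edge G u' v') →
      ¬ (u ≡ u' × v ≡ v') →
      ∀ (i : Fin (suc (ℓ (path u v lt e))))
        (j : Fin (suc (ℓ (path u' v' lt' e')))) →
      Internal (path u v lt e) i → Internal (path u' v' lt' e') j →
      p (path u v lt e) i ≢ p (path u' v' lt' e') j
    covers-vertices :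
      ∀ (x : Fin (n H)) →
      (∃ λ w → φ w ≡ x) ⊎
      (Σ (Fin (n G)) λ u → Σ (Fin (n G)) λ v →
       Σ (toℕ u < toℕ v) λ lt → Σ (Edge G u v) λ e →
       Σ (Fin (suc (ℓ (path u v lt e)))) λ i → p (path u v lt e) i ≡ x)
    covers-edges :
      ∀ (x y : Fin (n H)) → Edge H x y →
      Σ (Fin (n G)) λ u → Σ (Fin (n G)) λ v →
      Σ (toℕ u < toℕ v) λ lt → Σ (Edge G u v) λ e →
      Σ (Fin (suc (ℓ (path u v lt e)))) λ i →
      Σ (Fin (suc (ℓ (path u v lt e)))) λ j →
      suc (toℕ i) ≡ toℕ j ×
      ((p (path u v lt e) i ≡ x × p (path u v lt e) j ≡ y) ⊎
       (p (path u v lt e) i ≡ y × p (path u v lt e) j ≡ x))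

-- Every vertex of H is either a branch vertex φ z or an inner vertex of exactly one subdivided
-- path, and every edge of H is a step of exactly one subdivided path. A path of length ℓ has ℓ steps
-- and ℓ - 1 inner vertices, so |V(H)| + |E(G)| = |V(G)| + |E(H)|.
--
-- Replacing every edge of a cycle of G by its subdivided path gives a cycle of H through the same
-- branch vertices, and disjoint cycles stay disjoint; so if H has no k disjoint cycles, neither
-- has G. Conversely, let u, v be non-adjacent in G. Then φ u, φ v are non-adjacent in H, so H + φu φv
-- has k disjoint cycles. Each of them meets a branch vertex, and between consecutive branch vertices
-- it runs along a whole subdivided path or the new edge; its branch vertices, in order, therefore
-- form a cycle of G + uv (there are at least three, as one or two segments cannot close up), and these
-- cycles are again disjoint.
module Submission where

open import Defs
open import Axiom.UniquenessOfIdentityProofs.WithK using (uip)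
open import Data.Nat using (ℕ; zero; suc; _+_; _∸_; _*_; _≤_; _<_; z≤n; s≤s; s≤s⁻¹; pred; NonZero; >-nonZero; _%_)
open import Data.Nat.Properties
open import Data.Nat.DivMod using (m%n<n; %-distribˡ-+; m<n⇒m%n≡m; n%n≡0; [m+n]%n≡m%n; m≤n⇒[n∸m]%m≡n%m)
open import Data.Integer using (+_; _-_; _⊖_)
open import Data.Integer.Properties using (m-n≡m⊖n; +-cancelˡ-⊖)
open import Data.Fin using (Fin; zero; suc; toℕ; fromℕ<)
open import Data.Fin.Properties using (toℕ-injective; toℕ-fromℕ<; fromℕ<-toℕ; toℕ<n; any?; +↔⊎; cantor-schröder-bernstein)
import Data.Fin.Properties as Fin
open import Data.List using (List; []; _∷_; length; lookup; map; _++_; filter; allFin; cartesianProduct)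
open import Data.List.Properties using (length-++; length-map)
open import Data.List.Relation.Unary.All as All using (All; []; _∷_)
import Data.List.Relation.Unary.All.Properties as All
open import Data.List.Relation.Unary.Any using (here; there; index)
open import Data.List.Relation.Unary.Any.Properties using (lookup-index)
open import Data.List.Relation.Unary.AllPairs as AllPairs using (AllPairs; []; _∷_)
open import Data.List.Relation.Unary.Unique.Propositional using (Unique)
import Data.List.Relation.Unary.Unique.Propositional.Properties as Unique
open import Data.List.Membership.Propositional using (_∈_; _∉_)
open import Data.List.Membership.Propositional.Properties
  using (∈-lookup; ∈-++⁻; ∈-map⁻; ∈-filter⁺; ∈-filter⁻; ∈-allFin; ∈-cartesianProduct⁺)
open import Data.Product using (Σ; _×_; _,_; proj₁; proj₂; ∃; swap)
open import Data.Sum using (_⊎_; inj₁; inj₂)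
open import Data.Sum.Algebra using (⊎-cong; ⊎-assoc)
open import Data.Empty using (⊥; ⊥-elim)
open import Function.Base using (_∘_)
open import Function.Bundles using (_↔_; Injection; mk↔ₛ′)
open import Function.Related.Propositional using (module EquationalReasoning; bijection)
open import Function.Properties.Inverse using (↔-refl; ↔-sym; ↔-trans; ↔⇒↣)
open import Relation.Nullary using (¬_; yes; no)
open import Relation.Unary using (Decidable)
open import Relation.Binary.PropositionalEquality
open import Relation.Binary.Definitions using (tri<; tri≈; tri>)

range : ℕ → ℕ → List ℕ
range a zero = []
range a (suc c) = a ∷ range (suc a) c

length-range : ∀ a c → length (range a c) ≡ c
length-range a zero = refl
length-range a (suc c) = cong suc (length-range (suc a) c)

range-bounds : ∀ a c → All (λ t → a ≤ t × t < a + c) (range a c)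
range-bounds a zero = []
range-bounds a (suc c) = (≤-refl , subst (a <_) (sym (+-suc a c)) (s≤s (m≤m+n a c))) ∷
  All.map (λ {t} xy → <⇒≤ (proj₁ xy) , subst (t <_) (sym (+-suc a c)) (proj₂ xy)) (range-bounds (suc a) c)

range-unique : ∀ a c → Unique (range a c)
range-unique a zero = []
range-unique a (suc c) =
  All.map (λ xy e → <-irrefl e (proj₁ xy)) (range-bounds (suc a) c) ∷ range-unique (suc a) c

head∉tail : ∀ {A : Set} {x : A} {xs} → Unique (x ∷ xs) → x ∉ xs
head∉tail (x∉ ∷ _) m = All.lookup x∉ m refl

Unique-lookup-injective : ∀ {A : Set} {xs : List A} → Unique xs → (i j : Fin (length xs)) →
  lookup xs i ≡ lookup xs j → i ≡ j
Unique-lookup-injective (px ∷ u) zero zero eq = refl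
Unique-lookup-injective (px ∷ u) zero (suc j) eq = ⊥-elim (All.lookup px (∈-lookup j) eq)
Unique-lookup-injective (px ∷ u) (suc i) zero eq = ⊥-elim (All.lookup px (∈-lookup i) (sym eq))
Unique-lookup-injective (px ∷ u) (suc i) (suc j) eq = cong suc (Unique-lookup-injective u i j eq)

Unique-map⁺ : ∀ {A B : Set} (f : A → B) {xs : List A} (P : A → Set) → All P xs →
  (∀ {a b} → P a → P b → f a ≡ f b → a ≡ b) → Unique xs → Unique (map f xs)
Unique-map⁺ f P [] inj [] = []
Unique-map⁺ f P (pa ∷ ps) inj (d ∷ u) = fresh pa ps d ∷ Unique-map⁺ f P ps inj u
  where
  fresh : ∀ {a ys} → P a → All P ys → All (λ y → ¬ a ≡ y) ys → All (λ y → ¬ f a ≡ y) (map f ys)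
  fresh pa [] [] = []
  fresh pa (q ∷ qs) (nd ∷ nds) = (λ e → nd (inj pa q e)) ∷ fresh pa qs nds

data Chain {A : Set} (R : A → A → Set) : List A → A → Set where
  [_]  : ∀ {x b} → R x b → Chain R (x ∷ []) b
  _∷_ : ∀ {x y ys b} → R x y → Chain R (y ∷ ys) b → Chain R (x ∷ y ∷ ys) b

Chain-step : ∀ {A : Set} {R : A → A → Set} {xs b} → Chain R xs b →
  (i j : Fin (length xs)) → suc (toℕ i) ≡ toℕ j → R (lookup xs i) (lookup xs j)
Chain-step [ r ] zero zero ()
Chain-step (r ∷ ch) zero (suc zero) refl = r
Chain-step (r ∷ ch) zero (suc (suc j)) ()
Chain-step (r ∷ ch) (suc i) (suc j) eq = Chain-step ch i j (suc-injective eq)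
Chain-step (r ∷ ch) (suc i) zero ()

Chain-last : ∀ {A : Set} {R : A → A → Set} {xs b} → Chain R xs b →
  (i : Fin (length xs)) → suc (toℕ i) ≡ length xs → R (lookup xs i) b
Chain-last [ r ] zero refl = r
Chain-last (r ∷ ch) zero ()
Chain-last (r ∷ ch) (suc i) eq = Chain-last ch i (suc-injective eq)

Chain-++ : ∀ {A : Set} {R : A → A → Set} {xs y ys b} →
  Chain R xs y → Chain R (y ∷ ys) b → Chain R (xs ++ y ∷ ys) b
Chain-++ [ r ] ch = r ∷ ch
Chain-++ (r ∷ c) ch = r ∷ Chain-++ c ch

Chain-map-range : ∀ {A : Set} {R : A → A → Set} (f : ℕ → A) a c →
  (∀ t → a ≤ t → t < a + suc c → R (f t) (f (suc t))) →
  Chain R (map f (range a (suc c))) (f (a + suc c))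
Chain-map-range {R = R} f a zero step =
  [ subst (λ z → R (f a) (f z)) a+1 (step a ≤-refl (subst (a <_) a+1 ≤-refl)) ]
  where
  a+1 : suc a ≡ a + 1
  a+1 = sym (trans (+-suc a 0) (cong suc (+-identityʳ a)))
Chain-map-range {R = R} f a (suc c) step =
  step a ≤-refl (subst (a <_) (sym (+-suc a (suc c))) (s≤s (m≤m+n a (suc c)))) ∷
  subst (λ z → Chain R (map f (range (suc a) (suc c))) (f z)) (sym (+-suc a (suc c)))
    (Chain-map-range f (suc a) c (λ t a<t t< → step t (<⇒≤ a<t) (subst (t <_) (sym (+-suc a (suc c))) t<)))

Chain⇒Cycle : ∀ {m} {R : Fin m → Fin m → Set} (x : Fin m) (xs : List (Fin m)) →
  3 ≤ length (x ∷ xs) → Unique (x ∷ xs) → Chain R (x ∷ xs) x → Cycle R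
Chain⇒Cycle {R = R} x xs l≥3 u ch = record
  { len = length (x ∷ xs) ; len≥3 = l≥3 ; vs = lookup (x ∷ xs)
  ; vs-inj = λ {i} {j} → Unique-lookup-injective u i j
  ; vs-adj = step }
  where
  step : (i j : Fin (length (x ∷ xs))) →
    (suc (toℕ i) ≡ toℕ j ⊎ (suc (toℕ i) ≡ length (x ∷ xs) × toℕ j ≡ 0)) →
    R (lookup (x ∷ xs) i) (lookup (x ∷ xs) j)
  step i j (inj₁ e) = Chain-step ch i j e
  step i zero (inj₂ (e , _)) = Chain-last ch i e
  step i (suc j) (inj₂ (_ , ()))

Fin-↔⇒≡ : ∀ {m n} → Fin m ↔ Fin n → m ≡ n
Fin-↔⇒≡ e = cantor-schröder-bernstein (Injection.injective (↔⇒↣ e)) (Injection.injective (↔⇒↣ (↔-sym e)))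

filter↔Σ : ∀ {A : Set} {P : A → Set} (P? : Decidable P) → (∀ a (p q : P a) → p ≡ q) →
  (xs : List A) → Unique xs → (∀ a → a ∈ xs) → Fin (length (filter P? xs)) ↔ Σ A P
filter↔Σ {A} {P} P? P-irrelevant xs xs-unique xs-complete =
  mk↔ₛ′ to from to-from from-to
  where
  ys = filter P? xs
  to : Fin (length ys) → Σ A P
  to i = lookup ys i , proj₂ (∈-filter⁻ P? {xs = xs} (∈-lookup i))
  from : Σ A P → Fin (length ys)
  from (a , pa) = index (∈-filter⁺ P? (xs-complete a) pa)
  to-from : ∀ ap → to (from ap) ≡ ap
  to-from (a , pa) = Σ-≡ (sym (lookup-index (∈-filter⁺ P? (xs-complete a) pa)))
    where
    Σ-≡ : ∀ {b} {pb : P b} → b ≡ a → (b , pb) ≡ (a , pa)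
    Σ-≡ {pb = pb} refl = cong (a ,_) (P-irrelevant a pb pa)
  from-to : ∀ i → from (to i) ≡ i
  from-to i = Unique-lookup-injective (Unique.filter⁺ P? xs-unique) _ _ (sym (lookup-index (∈-filter⁺ P? (xs-complete (lookup ys i)) (proj₂ (to i)))))

Edges : Graph → Set
Edges G = Σ (Fin (n G)) λ u → Σ (Fin (n G)) λ v → toℕ u < toℕ v × Edge G u v

Edges-irrelevant : ∀ {K : Graph} {u v lt lt' E E'} → _≡_ {A = Edges K} (u , v , lt , E) (u , v , lt' , E')
Edges-irrelevant {lt = lt} {lt'} {E} {E'} = cong₂ (λ p q → _ , _ , p , q) (<-irrelevant lt lt') (uip E E')

Fin-∣E∣↔Edges : (G : Graph) → Fin (∣E∣ G) ↔ Edges G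
Fin-∣E∣↔Edges G = ↔-trans (filter↔Σ _ irrelevant pairs pairs-unique pairs-complete) uncurry↔
  where
  IsEdge : Fin (n G) × Fin (n G) → Set
  IsEdge (u , v) = toℕ u < toℕ v × Edge G u v
  irrelevant : ∀ uv (p q : IsEdge uv) → p ≡ q
  irrelevant uv (p₁ , p₂) (q₁ , q₂) = cong₂ _,_ (<-irrelevant p₁ q₁) (uip p₂ q₂)
  pairs = cartesianProduct (allFin (n G)) (allFin (n G))
  pairs-unique : Unique pairs
  pairs-unique = Unique.cartesianProduct⁺ (Unique.allFin⁺ (n G)) (Unique.allFin⁺ (n G))
  pairs-complete : ∀ uv → uv ∈ pairs
  pairs-complete (u , v) = ∈-cartesianProduct⁺ (∈-allFin u) (∈-allFin v)
  uncurry↔ : Σ (Fin (n G) × Fin (n G)) IsEdge ↔ Edges G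
  uncurry↔ = mk↔ₛ′ (λ ((u , v) , h) → u , v , h) (λ (u , v , h) → (u , v) , h) (λ _ → refl) (λ _ → refl)

Edge-sym : ∀ {K : Graph} {a b} → Edge K a b → Edge K b a
Edge-sym {K} {a} {b} e = trans (adj-sym K b a) e

Edge-irrefl : ∀ {K : Graph} {a} → ¬ Edge K a a
Edge-irrefl {K} {a} e with trans (sym e) (adj-irr K a)
... | ()

-- Paths indexed by ℕ, with junk value a beyond the end.
at : ∀ {H a b} → Path H a b → ℕ → Fin (n H)
at {a = a} P i with i <? suc (ℓ P)
... | yes h = p P (fromℕ< h)
... | no _ = a

at-fromℕ< : ∀ {H a b} (P : Path H a b) i (h : i < suc (ℓ P)) → at P i ≡ p P (fromℕ< h)
at-fromℕ< P i h with i <? suc (ℓ P)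
... | yes h' = cong (λ z → p P (fromℕ< z)) (<-irrelevant h' h)
... | no ¬h = ⊥-elim (¬h h)

at-toℕ : ∀ {H a b} (P : Path H a b) (i : Fin (suc (ℓ P))) → at P (toℕ i) ≡ p P i
at-toℕ P i = trans (at-fromℕ< P (toℕ i) (toℕ<n i)) (cong (p P) (fromℕ<-toℕ i (toℕ<n i)))

at-start : ∀ {H a b} (P : Path H a b) → at P 0 ≡ a
at-start P = trans (at-fromℕ< P 0 0<1+ℓ) (p-start P (fromℕ< 0<1+ℓ) (toℕ-fromℕ< 0<1+ℓ))
  where 0<1+ℓ = s≤s (z≤n {ℓ P})

at-end : ∀ {H a b} (P : Path H a b) → at P (ℓ P) ≡ b
at-end P = trans (at-fromℕ< P (ℓ P) ≤-refl) (p-end P (fromℕ< ℓ<1+ℓ) (toℕ-fromℕ< ℓ<1+ℓ))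
  where ℓ<1+ℓ = ≤-refl {suc (ℓ P)}

at-end′ : ∀ {H a b} (P : Path H a b) {i} → i ≡ ℓ P → at P i ≡ b
at-end′ P refl = at-end P

at-edge : ∀ {H a b} (P : Path H a b) i → i < ℓ P → Edge H (at P i) (at P (suc i))
at-edge {H} P i h =
  subst₂ (Edge H) (sym (at-fromℕ< P i (m<n⇒m<1+n h))) (sym (at-fromℕ< P (suc i) (s≤s h)))
    (p-adj P _ _ (trans (cong suc (toℕ-fromℕ< (m<n⇒m<1+n h))) (sym (toℕ-fromℕ< (s≤s h)))))

at-injective : ∀ {H a b} (P : Path H a b) i j → i ≤ ℓ P → j ≤ ℓ P → at P i ≡ at P j → i ≡ j
at-injective P i j i≤ℓ j≤ℓ eq =
  trans (sym (toℕ-fromℕ< (s≤s i≤ℓ)))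
    (trans (cong toℕ (p-inj P (trans (sym (at-fromℕ< P i (s≤s i≤ℓ)))
                                (trans eq (at-fromℕ< P j (s≤s j≤ℓ))))))
           (toℕ-fromℕ< (s≤s j≤ℓ)))

Internal-fromℕ< : ∀ {H a b} (P : Path H a b) {i} (i<ℓ : i < ℓ P) → 0 < i →
  Internal P (fromℕ< (m<n⇒m<1+n i<ℓ))
Internal-fromℕ< P i<ℓ 0<i = subst (0 <_) (sym t) 0<i , subst (_< ℓ P) (sym t) i<ℓ
  where t = toℕ-fromℕ< (m<n⇒m<1+n i<ℓ)

data Position (l i : ℕ) : Set where
  start : i ≡ 0 → Position l i
  end   : i ≡ l → Position l i
  inner : 0 < i → i < l → Position l i

position : ∀ l i → i ≤ l → Position l i
position l zero h = start refl
position l (suc i) h with m≤n⇒m<n∨m≡n h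
... | inj₁ lt = inner (s≤s z≤n) lt
... | inj₂ eq = end eq

Unordered≡ : ∀ {A : Set} → A → A → A → A → Set
Unordered≡ x y x' y' = (x ≡ x' × y ≡ y') ⊎ (x ≡ y' × y ≡ x')

Unordered≡-sym : ∀ {A : Set} {x y x' y' : A} → Unordered≡ x y x' y' → Unordered≡ x' y' x y
Unordered≡-sym (inj₁ (p , q)) = inj₁ (sym p , sym q)
Unordered≡-sym (inj₂ (p , q)) = inj₂ (sym q , sym p)

Unordered≡-trans : ∀ {A : Set} {x y x' y' x'' y'' : A} →
  Unordered≡ x y x' y' → Unordered≡ x' y' x'' y'' → Unordered≡ x y x'' y''
Unordered≡-trans (inj₁ (p , q)) (inj₁ (p' , q')) = inj₁ (trans p p' , trans q q')
Unordered≡-trans (inj₁ (p , q)) (inj₂ (p' , q')) = inj₂ (trans p p' , trans q q')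
Unordered≡-trans (inj₂ (p , q)) (inj₁ (p' , q')) = inj₂ (trans p q' , trans q p')
Unordered≡-trans (inj₂ (p , q)) (inj₂ (p' , q')) = inj₁ (trans p q' , trans q p')

¬swapped< : ∀ {m} {u v u' v' : Fin m} → u ≡ v' → v ≡ u' → toℕ u < toℕ v → ¬ toℕ u' < toℕ v'
¬swapped< refl refl = <-asym

module Subdivision (G H : Graph) (S : SubdivisionOf H G) where
  open SubdivisionOf S public

  VH : Set
  VH = Fin (n H)

  VG : Set
  VG = Fin (n G)

  Inner : VG → VG → VH → Set
  Inner u v x = Σ (toℕ u < toℕ v) λ lt → Σ (Edge G u v) λ e → Σ ℕ λ i →
    0 < i × i < ℓ (path u v lt e) × at (path u v lt e) i ≡ x

  Inner⇒¬branch : ∀ {u v x} → Inner u v x → ∀ w → x ≢ φ w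
  Inner⇒¬branch {u} {v} (lt , e , i , 0<i , i<ℓ , refl) w =
    internal-not-branch u v lt e _ (Internal-fromℕ< P i<ℓ 0<i) w ∘ trans (sym (at-fromℕ< P i (m<n⇒m<1+n i<ℓ)))
    where P = path u v lt e

  Inner-disjoint : ∀ {u v u' v' x} → Inner u v x → Inner u' v' x → ¬ (u ≡ u' × v ≡ v') → ⊥
  Inner-disjoint {u} {v} {u'} {v'} (lt , e , i , 0<i , i<ℓ , refl) (lt' , e' , i' , 0<i' , i'<ℓ' , eq) distinct =
    internally-disjoint u v lt e u' v' lt' e' distinct _ _ (Internal-fromℕ< P i<ℓ 0<i) (Internal-fromℕ< P' i'<ℓ' 0<i')
      (trans (sym (at-fromℕ< P i (m<n⇒m<1+n i<ℓ))) (trans (sym eq) (at-fromℕ< P' i' (m<n⇒m<1+n i'<ℓ'))))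
    where
    P = path u v lt e
    P' = path u' v' lt' e'

  Inner-unique : ∀ {u v u' v' x} → Inner u v x → Inner u' v' x → u ≡ u' × v ≡ v'
  Inner-unique {u} {v} {u'} {v'} x∈uv x∈u'v' with u Fin.≟ u' | v Fin.≟ v'
  ... | yes u≡u' | yes v≡v' = u≡u' , v≡v'
  ... | no u≢u' | _ = ⊥-elim (Inner-disjoint x∈uv x∈u'v' (u≢u' ∘ proj₁))
  ... | yes _ | no v≢v' = ⊥-elim (Inner-disjoint x∈uv x∈u'v' (v≢v' ∘ proj₂))

  branch-position : ∀ u v lt e i w → i ≤ ℓ (path u v lt e) → at (path u v lt e) i ≡ φ w →
    (i ≡ 0 × w ≡ u) ⊎ (i ≡ ℓ (path u v lt e) × w ≡ v)
  branch-position u v lt e i w h eq with position _ i h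
  ... | start refl = inj₁ (refl , φ-inj (trans (sym eq) (at-start (path u v lt e))))
  ... | end refl = inj₂ (refl , φ-inj (trans (sym eq) (at-end (path u v lt e))))
  ... | inner a b = ⊥-elim (Inner⇒¬branch (lt , e , i , a , b , refl) w eq)

  PathStep : VH → VH → Set
  PathStep x y = Σ VG λ u → Σ VG λ v → Σ (toℕ u < toℕ v) λ lt → Σ (Edge G u v) λ e → Σ ℕ λ i →
    suc i ≤ ℓ (path u v lt e) × Unordered≡ (at (path u v lt e) i) (at (path u v lt e) (suc i)) x y

  edge⇒PathStep : ∀ x y → Edge H x y → PathStep x y
  edge⇒PathStep x y E with covers-edges x y E
  ... | u , v , lt , e , i , j , sij , or = u , v , lt , e , toℕ i , bound , or2 or
    where
    P = path u v lt e
    bound : suc (toℕ i) ≤ ℓ P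
    bound = subst (_≤ ℓ P) (sym sij) (s≤s⁻¹ (toℕ<n j))
    q1 : at P (toℕ i) ≡ p P i
    q1 = at-toℕ P i
    q2 : at P (suc (toℕ i)) ≡ p P j
    q2 = trans (cong (at P) sij) (at-toℕ P j)
    or2 : Unordered≡ (p P i) (p P j) x y → Unordered≡ (at P (toℕ i)) (at P (suc (toℕ i))) x y
    or2 (inj₁ (a , b)) = inj₁ (trans q1 a , trans q2 b)
    or2 (inj₂ (a , b)) = inj₂ (trans q1 a , trans q2 b)

  inner-neighbours : ∀ u v lt e i y → 0 < i → i < ℓ (path u v lt e) → Edge H (at (path u v lt e) i) y →
    y ≡ at (path u v lt e) (pred i) ⊎ y ≡ at (path u v lt e) (suc i)
  inner-neighbours u v lt e i y 0<i i<ℓ E with edge⇒PathStep _ _ E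
  ... | u' , v' , lt' , e' , j , j<ℓ' , inj₁ (eq , eq') with position (ℓ (path u' v' lt' e')) j (<⇒≤ j<ℓ')
  ...   | start refl = ⊥-elim (Inner⇒¬branch x∈uv u' (trans (sym eq) (at-start (path u' v' lt' e'))))
    where x∈uv = lt , e , i , 0<i , i<ℓ , refl
  ...   | end j≡ℓ' = ⊥-elim (<-irrefl j≡ℓ' j<ℓ')
  ...   | inner 0<j _ with Inner-unique (lt' , e' , j , 0<j , j<ℓ' , eq) (lt , e , i , 0<i , i<ℓ , refl)
  ...     | refl , refl with at-injective (path u v lt e) j i (<⇒≤ j<ℓ') (<⇒≤ i<ℓ) eq
  ...       | refl = inj₂ (sym eq')
  inner-neighbours u v lt e i y 0<i i<ℓ E | u' , v' , lt' , e' , j , j<ℓ' , inj₂ (eq , eq')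
    with position (ℓ (path u' v' lt' e')) (suc j) j<ℓ'
  ...   | start ()
  ...   | end j≡ℓ' = ⊥-elim (Inner⇒¬branch x∈uv v' (trans (sym eq') (at-end′ (path u' v' lt' e') j≡ℓ')))
    where x∈uv = lt , e , i , 0<i , i<ℓ , refl
  ...   | inner 0<1+j 1+j<ℓ' with Inner-unique (lt' , e' , suc j , 0<1+j , 1+j<ℓ' , eq') (lt , e , i , 0<i , i<ℓ , refl)
  ...     | refl , refl with at-injective (path u v lt e) (suc j) i (<⇒≤ 1+j<ℓ') (<⇒≤ i<ℓ) eq'
  ...       | refl = inj₁ (sym eq)

  branch-edge : ∀ a b → Edge H (φ a) (φ b) → Edge G a b
  branch-edge a b E with edge⇒PathStep _ _ E
  ... | u , v , lt , e , i , hb , inj₁ (x1 , x2) with branch-position u v lt e i a (≤-trans (n≤1+n i) hb) x1 | branch-position u v lt e (suc i) b hb x2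
  ...   | inj₁ (_ , refl) | inj₂ (_ , refl) = e
  ...   | inj₂ (eq , _) | _ = ⊥-elim (<-irrefl eq hb)
  ...   | inj₁ _ | inj₁ (() , _)
  branch-edge a b E | u , v , lt , e , i , hb , inj₂ (x1 , x2) with branch-position u v lt e i b (≤-trans (n≤1+n i) hb) x1 | branch-position u v lt e (suc i) a hb x2
  ...   | inj₁ (_ , refl) | inj₂ (_ , refl) = Edge-sym {G} e
  ...   | inj₂ (eq , _) | _ = ⊥-elim (<-irrefl eq hb)
  ...   | inj₁ _ | inj₁ (() , _)


module Counting (G H : Graph) (S : SubdivisionOf H G) where
  open Subdivision G H S

  pathLength : Edges G → ℕ
  pathLength (u , v , lt , E) = ℓ (path u v lt E)

  Step : Set
  Step = Σ (Edges G) λ e → Σ ℕ λ i → i < pathLength e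

  InnerIndex : Set
  InnerIndex = Σ (Edges G) λ e → Σ ℕ λ i → 0 < i × i < pathLength e

  Step-irrelevant : ∀ {u v lt lt' E E' i h h'} →
    _≡_ {A = Step} ((u , v , lt , E) , i , h) ((u , v , lt' , E') , i , h')
  Step-irrelevant {lt = lt} {lt'} {E} {E'} {h = h} {h'} with <-irrelevant lt lt' | uip E E'
  ... | refl | refl = cong (λ h″ → (_ , _ , lt , E) , _ , h″) (<-irrelevant h h')

  InnerIndex-irrelevant : ∀ {u v lt lt' E E' i a a' b b'} →
    _≡_ {A = InnerIndex} ((u , v , lt , E) , i , a , b) ((u , v , lt' , E') , i , a' , b')
  InnerIndex-irrelevant {lt = lt} {lt'} {E} {E'} {a = a} {a'} {b} {b'} with <-irrelevant lt lt' | uip E E'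
  ... | refl | refl = cong₂ (λ a″ b″ → (_ , _ , lt , E) , _ , a″ , b″) (<-irrelevant a a') (<-irrelevant b b')

  InnerIndex⊎Edges↔Step : (InnerIndex ⊎ Edges G) ↔ Step
  InnerIndex⊎Edges↔Step = mk↔ₛ′ split merge split∘merge merge∘split
    where
    split : InnerIndex ⊎ Edges G → Step
    split (inj₁ (e , i , a , b)) = e , i , b
    split (inj₂ (u , v , lt , E)) = (u , v , lt , E) , 0 , ℓ≥1 (path u v lt E)
    merge : Step → InnerIndex ⊎ Edges G
    merge (e , zero , h) = inj₂ e
    merge (e , suc i , h) = inj₁ (e , suc i , s≤s z≤n , h)
    merge∘split : ∀ x → merge (split x) ≡ x
    merge∘split (inj₁ (e , zero , () , b))
    merge∘split (inj₁ (e , suc i , a , b)) = cong (λ z → inj₁ (e , suc i , z , b)) (<-irrelevant _ a)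
    merge∘split (inj₂ e) = refl
    split∘merge : ∀ y → split (merge y) ≡ y
    split∘merge ((u , v , lt , E) , zero , h) = cong (λ z → (u , v , lt , E) , 0 , z) (<-irrelevant _ h)
    split∘merge (e , suc i , h) = refl

  inner-at-unique : ∀ u v lt E k u' v' lt' E' k' → 0 < k → k < ℓ (path u v lt E) → k' ≤ ℓ (path u' v' lt' E') →
    at (path u v lt E) k ≡ at (path u' v' lt' E') k' → u ≡ u' × v ≡ v' × k ≡ k'
  inner-at-unique u v lt E k u' v' lt' E' k' 0<k k<ℓ k'≤ℓ' eq with position (ℓ (path u' v' lt' E')) k' k'≤ℓ'
  ... | start refl = ⊥-elim (Inner⇒¬branch (lt , E , k , 0<k , k<ℓ , refl) u' (trans eq (at-start (path u' v' lt' E'))))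
  ... | end refl = ⊥-elim (Inner⇒¬branch (lt , E , k , 0<k , k<ℓ , refl) v' (trans eq (at-end (path u' v' lt' E'))))
  ... | inner 0<k' k'<ℓ' with Inner-unique (lt , E , k , 0<k , k<ℓ , refl) (lt' , E' , k' , 0<k' , k'<ℓ' , sym eq)
  ...   | refl , refl = refl , refl , at-injective (path u v lt E) k k' (<⇒≤ k<ℓ) k'≤ℓ' eq

  inner-step-unique : ∀ u v lt E i u' v' lt' E' i' → 0 < i → i < ℓ (path u v lt E) → suc i' ≤ ℓ (path u' v' lt' E') →
    Unordered≡ (at (path u v lt E) i) (at (path u v lt E) (suc i)) (at (path u' v' lt' E') i') (at (path u' v' lt' E') (suc i')) →
    u ≡ u' × v ≡ v' × i ≡ i'
  inner-step-unique u v lt E i u' v' lt' E' i' 0<i i<ℓ i'<ℓ' (inj₁ (eq , _)) =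
    inner-at-unique u v lt E i u' v' lt' E' i' 0<i i<ℓ (<⇒≤ i'<ℓ') eq
  inner-step-unique u v lt E i u' v' lt' E' i' 0<i i<ℓ i'<ℓ' (inj₂ (eq , eq'))
    with inner-at-unique u v lt E i u' v' lt' E' (suc i') 0<i i<ℓ i'<ℓ' eq
  ... | refl , refl , refl = ⊥-elim (<⇒≢ (m<n⇒m<1+n (n<1+n i')) (sym (at-injective (path u v lt E) _ _ i<ℓ (<⇒≤ i'<ℓ') eq')))

  first-step-unique : ∀ u v lt E u' v' lt' E' i' → 1 < ℓ (path u v lt E) → suc i' ≤ ℓ (path u' v' lt' E') →
    Unordered≡ (at (path u v lt E) 0) (at (path u v lt E) 1) (at (path u' v' lt' E') i') (at (path u' v' lt' E') (suc i')) →
    u ≡ u' × v ≡ v' × 0 ≡ i'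
  first-step-unique u v lt E u' v' lt' E' i' 1<ℓ i'<ℓ' (inj₁ (_ , eq)) with inner-at-unique u v lt E 1 u' v' lt' E' (suc i') (s≤s z≤n) 1<ℓ i'<ℓ' eq
  ... | refl , refl , 1≡1+i' = refl , refl , cong pred 1≡1+i'
  first-step-unique u v lt E u' v' lt' E' i' 1<ℓ i'<ℓ' (inj₂ (eq , eq')) with inner-at-unique u v lt E 1 u' v' lt' E' i' (s≤s z≤n) 1<ℓ (<⇒≤ i'<ℓ') eq'
  ... | refl , refl , refl with at-injective (path u v lt E) 0 2 z≤n 1<ℓ eq
  ...   | ()

  single-step-unique : ∀ u v lt E u' v' lt' E' i' → 1 ≡ ℓ (path u v lt E) → suc i' ≤ ℓ (path u' v' lt' E') →
    Unordered≡ (at (path u v lt E) 0) (at (path u v lt E) 1) (at (path u' v' lt' E') i') (at (path u' v' lt' E') (suc i')) →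
    u ≡ u' × v ≡ v' × 0 ≡ i'
  single-step-unique u v lt E u' v' lt' E' i' 1≡ℓ i'<ℓ' (inj₁ (eq₀ , eq₁))
    with branch-position u' v' lt' E' i' u (<⇒≤ i'<ℓ') (trans (sym eq₀) (at-start (path u v lt E)))
       | branch-position u' v' lt' E' (suc i') v i'<ℓ' (trans (sym eq₁) (at-end′ (path u v lt E) 1≡ℓ))
  ... | inj₂ (i'≡ℓ' , _) | _ = ⊥-elim (<-irrefl i'≡ℓ' i'<ℓ')
  ... | inj₁ _ | inj₁ (() , _)
  ... | inj₁ (i'≡0 , u≡u') | inj₂ (_ , v≡v') = u≡u' , v≡v' , sym i'≡0
  single-step-unique u v lt E u' v' lt' E' i' 1≡ℓ i'<ℓ' (inj₂ (eq₀ , eq₁))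
    with branch-position u' v' lt' E' (suc i') u i'<ℓ' (trans (sym eq₀) (at-start (path u v lt E)))
       | branch-position u' v' lt' E' i' v (<⇒≤ i'<ℓ') (trans (sym eq₁) (at-end′ (path u v lt E) 1≡ℓ))
  ... | inj₁ (() , _) | _
  ... | inj₂ _ | inj₂ (i'≡ℓ' , _) = ⊥-elim (<-irrefl i'≡ℓ' i'<ℓ')
  ... | inj₂ (_ , u≡v') | inj₁ (_ , v≡u') = ⊥-elim (¬swapped< u≡v' v≡u' lt lt')

  Step-unique : ∀ u v lt E i u' v' lt' E' i' → suc i ≤ ℓ (path u v lt E) → suc i' ≤ ℓ (path u' v' lt' E') →
    Unordered≡ (at (path u v lt E) i) (at (path u v lt E) (suc i)) (at (path u' v' lt' E') i') (at (path u' v' lt' E') (suc i')) →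
    u ≡ u' × v ≡ v' × i ≡ i'
  Step-unique u v lt E i u' v' lt' E' i' i<ℓ i'<ℓ' same with position (ℓ (path u v lt E)) i (<⇒≤ i<ℓ)
  ... | end i≡ℓ = ⊥-elim (<-irrefl i≡ℓ i<ℓ)
  ... | inner 0<i _ = inner-step-unique u v lt E i u' v' lt' E' i' 0<i i<ℓ i'<ℓ' same
  ... | start refl with position (ℓ (path u v lt E)) 1 i<ℓ
  ...   | start ()
  ...   | inner _ 1<ℓ = first-step-unique u v lt E u' v' lt' E' i' 1<ℓ i'<ℓ' same
  ...   | end 1≡ℓ = single-step-unique u v lt E u' v' lt' E' i' 1≡ℓ i'<ℓ' same

  orient : ∀ a b → Edge H a b → Edges H
  orient a b E with <-cmp (toℕ a) (toℕ b)
  ... | tri< lt _ _ = a , b , lt , E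
  ... | tri≈ _ eq _ = ⊥-elim (Edge-irrefl {H} (subst (Edge H a) (sym (toℕ-injective eq)) E))
  ... | tri> _ _ gt = b , a , gt , Edge-sym {H} E

  orient-ends : ∀ a b E → Unordered≡ a b (proj₁ (orient a b E)) (proj₁ (proj₂ (orient a b E)))
  orient-ends a b E with <-cmp (toℕ a) (toℕ b)
  ... | tri< lt _ _ = inj₁ (refl , refl)
  ... | tri≈ _ eq _ = ⊥-elim (Edge-irrefl {H} (subst (Edge H a) (sym (toℕ-injective eq)) E))
  ... | tri> _ _ gt = inj₂ (refl , refl)

  orient-≡ : ∀ x y (lt : toℕ x < toℕ y) E' a b E → Unordered≡ a b x y →
    orient a b E ≡ (x , y , lt , E')
  orient-≡ x y lt E' a b E (inj₁ (refl , refl)) with <-cmp (toℕ a) (toℕ b)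
  ... | tri< lt2 _ _ = Edges-irrelevant {H}
  ... | tri≈ _ eq _ = ⊥-elim (<-irrefl eq lt)
  ... | tri> _ _ gt = ⊥-elim (<-asym lt gt)
  orient-≡ x y lt E' a b E (inj₂ (refl , refl)) with <-cmp (toℕ a) (toℕ b)
  ... | tri< lt2 _ _ = ⊥-elim (<-asym lt lt2)
  ... | tri≈ _ eq _ = ⊥-elim (<-irrefl (sym eq) lt)
  ... | tri> _ _ gt = Edges-irrelevant {H}

  stepEdge : Step → Edges H
  stepEdge ((u , v , lt , E) , i , h) = orient (at (path u v lt E) i) (at (path u v lt E) (suc i)) (at-edge (path u v lt E) i h)

  pathStepIndex : ∀ {x y} → PathStep x y → Step
  pathStepIndex (u , v , lt , E , i , hb , _) = (u , v , lt , E) , i , hb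

  edgeStep : Edges H → Step
  edgeStep (x , y , lt , E) = pathStepIndex (edge⇒PathStep x y E)

  stepEdge∘pathStepIndex : ∀ x y lt E (c : PathStep x y) → stepEdge (pathStepIndex c) ≡ (x , y , lt , E)
  stepEdge∘pathStepIndex x y lt E (u , v , lt' , E' , i , hb , or) =
    orient-≡ x y lt E (at (path u v lt' E') i) (at (path u v lt' E') (suc i)) _ or

  pathStepIndex-unique : ∀ u v lt E i h x y (c : PathStep x y) →
    Unordered≡ (at (path u v lt E) i) (at (path u v lt E) (suc i)) x y →
    pathStepIndex c ≡ ((u , v , lt , E) , i , h)
  pathStepIndex-unique u v lt E i h x y (u' , v' , lt' , E' , i' , i'<ℓ' , same') same
    with Step-unique u' v' lt' E' i' u v lt E i i'<ℓ' h (Unordered≡-trans same' (Unordered≡-sym same))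
  ... | refl , refl , refl = Step-irrelevant

  Step↔Edges : Step ↔ Edges H
  Step↔Edges = mk↔ₛ′ stepEdge edgeStep (λ (x , y , lt , E) → stepEdge∘pathStepIndex x y lt E (edge⇒PathStep x y E)) edgeStep∘stepEdge
    where
    edgeStep∘stepEdge : ∀ p → edgeStep (stepEdge p) ≡ p
    edgeStep∘stepEdge ((u , v , lt , E) , i , h) with orient (at (path u v lt E) i) (at (path u v lt E) (suc i)) (at-edge (path u v lt E) i h)
      | orient-ends (at (path u v lt E) i) (at (path u v lt E) (suc i)) (at-edge (path u v lt E) i h)
    ... | x , y , lt2 , E2 | pr = pathStepIndex-unique u v lt E i h x y (edge⇒PathStep x y E2) pr

  Covered : VH → Set
  Covered x = (∃ λ w → φ w ≡ x) ⊎
         (Σ VG λ u → Σ VG λ v → Σ (toℕ u < toℕ v) λ lt → Σ (Edge G u v) λ e →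
          Σ (Fin (suc (ℓ (path u v lt e)))) λ i → p (path u v lt e) i ≡ x)

  classify : ∀ u v lt E k → Position (ℓ (path u v lt E)) k → VG ⊎ InnerIndex
  classify u v lt E k (start _) = inj₁ u
  classify u v lt E k (end _) = inj₁ v
  classify u v lt E k (inner a b) = inj₂ ((u , v , lt , E) , k , a , b)

  classify-covered : ∀ x → Covered x → VG ⊎ InnerIndex
  classify-covered x (inj₁ (z , _)) = inj₁ z
  classify-covered x (inj₂ (u , v , lt , E , i , _)) = classify u v lt E (toℕ i) (position _ (toℕ i) (s≤s⁻¹ (toℕ<n i)))

  realise : VG ⊎ InnerIndex → VH
  realise (inj₁ z) = φ z
  realise (inj₂ ((u , v , lt , E) , k , a , b)) = at (path u v lt E) k

  realise-classify : ∀ u v lt E k (d : Position (ℓ (path u v lt E)) k) → realise (classify u v lt E k d) ≡ at (path u v lt E) k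
  realise-classify u v lt E k (start refl) = sym (at-start (path u v lt E))
  realise-classify u v lt E k (end refl) = sym (at-end (path u v lt E))
  realise-classify u v lt E k (inner a b) = refl

  realise∘classify : ∀ x (c : Covered x) → realise (classify-covered x c) ≡ x
  realise∘classify x (inj₁ (z , e)) = e
  realise∘classify x (inj₂ (u , v , lt , E , i , eq)) =
    trans (realise-classify u v lt E (toℕ i) (position _ (toℕ i) (s≤s⁻¹ (toℕ<n i)))) (trans (at-toℕ (path u v lt E) i) eq)

  classify-branch : ∀ u v lt E k z (d : Position (ℓ (path u v lt E)) k) → at (path u v lt E) k ≡ φ z → classify u v lt E k d ≡ inj₁ z
  classify-branch u v lt E k z (start refl) eq = cong inj₁ (φ-inj (trans (sym (at-start (path u v lt E))) eq))
  classify-branch u v lt E k z (end refl) eq = cong inj₁ (φ-inj (trans (sym (at-end (path u v lt E))) eq))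
  classify-branch u v lt E k z (inner a b) eq = ⊥-elim (Inner⇒¬branch (lt , E , k , a , b , refl) z eq)

  classify-inner : ∀ u v lt E k (d : Position (ℓ (path u v lt E)) k) u' v' lt' E' k' a' b' →
    at (path u v lt E) k ≡ at (path u' v' lt' E') k' →
    classify u v lt E k d ≡ inj₂ ((u' , v' , lt' , E') , k' , a' , b')
  classify-inner u v lt E k (start refl) u' v' lt' E' k' a' b' eq =
    ⊥-elim (Inner⇒¬branch (lt' , E' , k' , a' , b' , refl) u (trans (sym eq) (at-start (path u v lt E))))
  classify-inner u v lt E k (end refl) u' v' lt' E' k' a' b' eq =
    ⊥-elim (Inner⇒¬branch (lt' , E' , k' , a' , b' , refl) v (trans (sym eq) (at-end (path u v lt E))))
  classify-inner u v lt E k (inner a b) u' v' lt' E' k' a' b' eq with inner-at-unique u' v' lt' E' k' u v lt E k a' b' (<⇒≤ b) (sym eq)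
  ... | refl , refl , refl = cong inj₂ InnerIndex-irrelevant

  classify∘realise : ∀ y (c : Covered (realise y)) → classify-covered (realise y) c ≡ y
  classify∘realise (inj₁ z) (inj₁ (z' , e)) = cong inj₁ (φ-inj e)
  classify∘realise (inj₁ z) (inj₂ (u , v , lt , E , i , eq)) = classify-branch u v lt E (toℕ i) z _ (trans (at-toℕ (path u v lt E) i) eq)
  classify∘realise (inj₂ ((u , v , lt , E) , k , a , b)) (inj₁ (z , e)) = ⊥-elim (Inner⇒¬branch (lt , E , k , a , b , refl) z (sym e))
  classify∘realise (inj₂ ((u , v , lt , E) , k , a , b)) (inj₂ (u' , v' , lt' , E' , i , eq)) =
    classify-inner u' v' lt' E' (toℕ i) _ u v lt E k a b (trans (at-toℕ (path u' v' lt' E') i) eq)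

  VH↔VG⊎InnerIndex : VH ↔ (VG ⊎ InnerIndex)
  VH↔VG⊎InnerIndex = mk↔ₛ′ (λ x → classify-covered x (covers-vertices x)) realise
    (λ y → classify∘realise y (covers-vertices (realise y))) (λ x → realise∘classify x (covers-vertices x))

  vertices+edges : n H + ∣E∣ G ≡ n G + ∣E∣ H
  vertices+edges = Fin-↔⇒≡ (begin
    Fin (n H + ∣E∣ G)               ↔⟨ +↔⊎ ⟩
    (VH ⊎ Fin (∣E∣ G))              ↔⟨ ⊎-cong VH↔VG⊎InnerIndex (Fin-∣E∣↔Edges G) ⟩
    ((VG ⊎ InnerIndex) ⊎ Edges G)   ↔⟨ ⊎-assoc _ VG InnerIndex (Edges G) ⟩
    (VG ⊎ (InnerIndex ⊎ Edges G))   ↔⟨ ⊎-cong ↔-refl InnerIndex⊎Edges↔Step ⟩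
    (VG ⊎ Step)                     ↔⟨ ⊎-cong ↔-refl Step↔Edges ⟩
    (VG ⊎ Edges H)                  ↔⟨ ⊎-cong ↔-refl (Fin-∣E∣↔Edges H) ⟨
    (VG ⊎ Fin (∣E∣ H))              ↔⟨ +↔⊎ ⟨
    Fin (n G + ∣E∣ H)               ∎)
    where open EquationalReasoning {k = bijection}

%-shift-≢ : ∀ L .{{_ : NonZero L}} i d → 0 < d → d < L → (i + d) % L ≢ i % L
%-shift-≢ L i d d0 dL eq with (i % L) + d <? L
... | yes lt = <-irrefl refl (subst (i % L <_) e1 (m<m+n (i % L) d0))
  where
  e1 : (i % L) + d ≡ i % L
  e1 = trans (sym (m<n⇒m%n≡m lt)) (trans (cong (λ z → (i % L + z) % L) (sym (m<n⇒m%n≡m dL)))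
         (trans (sym (%-distribˡ-+ i d L)) eq))
... | no ge = <-irrefl refl (subst (_< L) dL' dL)
  where
  r = i % L
  Lle : L ≤ r + d
  Lle = ≮⇒≥ ge
  lt2 : r + d ∸ L < L
  lt2 = +-cancelʳ-< _ _ L (subst (_< L + L) (sym (m∸n+n≡m Lle)) (+-mono-< (m%n<n i L) dL))
  e1 : r + d ∸ L ≡ r
  e1 = trans (sym (m<n⇒m%n≡m lt2)) (trans (m≤n⇒[n∸m]%m≡n%m Lle)
         (trans (cong (λ z → (r + z) % L) (sym (m<n⇒m%n≡m dL))) (trans (sym (%-distribˡ-+ i d L)) eq)))
  dL' : d ≡ L
  dL' = +-cancelˡ-≡ r d L (trans (sym (m∸n+n≡m Lle)) (trans (cong (_+ L) e1) refl))

module CycleWalk {m} {R : Fin m → Fin m → Set} (C : Cycle R) where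
  L : ℕ
  L = len C

  instance
    nz : NonZero L
    nz = >-nonZero (≤-trans (s≤s z≤n) (len≥3 C))

  1<L : 1 < L
  1<L = ≤-trans (s≤s (s≤s z≤n)) (len≥3 C)

  wrap : ℕ → Fin L
  wrap j = fromℕ< (m%n<n j L)

  toℕ-wrap : ∀ j → toℕ (wrap j) ≡ j % L
  toℕ-wrap j = toℕ-fromℕ< (m%n<n j L)

  w : ℕ → Fin m
  w j = vs C (wrap j)

  suc-% : ∀ j → suc j % L ≡ suc (j % L) % L
  suc-% j = trans (%-distribˡ-+ 1 j L) (cong (λ z → (z + j % L) % L) (m<n⇒m%n≡m 1<L))

  w-step : ∀ j → R (w j) (w (suc j))
  w-step j with m≤n⇒m<n∨m≡n (m%n<n j L)
  ... | inj₁ lt = vs-adj C (wrap j) (wrap (suc j))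
        (inj₁ (trans (cong suc (toℕ-wrap j)) (sym (trans (toℕ-wrap (suc j)) (trans (suc-% j) (m<n⇒m%n≡m lt))))))
  ... | inj₂ eq = vs-adj C (wrap j) (wrap (suc j))
        (inj₂ (trans (cong suc (toℕ-wrap j)) eq , trans (toℕ-wrap (suc j)) (trans (suc-% j) (trans (cong (_% L) eq) (n%n≡0 L)))))

  w-periodic : ∀ j → w (j + L) ≡ w j
  w-periodic j = cong (vs C) (toℕ-injective (trans (toℕ-wrap (j + L)) (trans ([m+n]%n≡m%n j L) (sym (toℕ-wrap j)))))

  w-injective : ∀ i j → i < j → j < i + L → w i ≢ w j
  w-injective i j ij jL eq = %-shift-≢ L i (j ∸ i) (m<n⇒0<n∸m ij)
    (subst (j ∸ i <_) (m+n∸m≡n i L) (∸-monoˡ-< jL (<⇒≤ ij)))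
    (trans (cong (_% L) (m+[n∸m]≡n (<⇒≤ ij)))
      (trans (sym (toℕ-wrap j)) (trans (cong toℕ (vs-inj C (sym eq))) (toℕ-wrap i))))

  w-injective-< : ∀ {i j} → i < L → j < L → w i ≡ w j → i ≡ j
  w-injective-< {i} {j} i<L j<L eq with <-cmp i j
  ... | tri< i<j _ _ = ⊥-elim (w-injective i j i<j (<-≤-trans j<L (m≤n+m L i)) eq)
  ... | tri≈ _ i≡j _ = i≡j
  ... | tri> _ _ j<i = ⊥-elim (w-injective j i j<i (<-≤-trans i<L (m≤n+m L j)) (sym eq))

module ProjectWalk (G H : Graph) (S : SubdivisionOf H G) (u0 v0 : Fin (n G))
  (uv : u0 ≢ v0) (nadj : ¬ Edge G u0 v0)
  (w : ℕ → Fin (n H))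
  (w-step : ∀ j → EdgePlus H (SubdivisionOf.φ S u0) (SubdivisionOf.φ S v0) (w j) (w (suc j)))
  (L : ℕ) (L≥3 : 3 ≤ L)
  (w-periodic : ∀ j → w (j + L) ≡ w j)
  (w-injective : ∀ i j → i < j → j < i + L → w i ≢ w j) where
  open Subdivision G H S

  EdgeH⁺ : VH → VH → Set
  EdgeH⁺ = EdgePlus H (φ u0) (φ v0)

  EdgeG⁺ : VG → VG → Set
  EdgeG⁺ = EdgePlus G u0 v0

  no-backtrack : ∀ j → w (suc (suc j)) ≢ w j
  no-backtrack j eq = w-injective j (suc (suc j)) (s≤s (n≤1+n j))
    (≤-trans (+-monoˡ-≤ j L≥3) (≤-reflexive (+-comm L j))) (sym eq)

  inner-neighbours⁺ : ∀ u v lt e i y → 0 < i → i < ℓ (path u v lt e) → EdgeH⁺ (at (path u v lt e) i) y →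
    y ≡ at (path u v lt e) (pred i) ⊎ y ≡ at (path u v lt e) (suc i)
  inner-neighbours⁺ u v lt e i y h0 hl (inj₁ E) = inner-neighbours u v lt e i y h0 hl E
  inner-neighbours⁺ u v lt e i y h0 hl (inj₂ (inj₁ (a , _))) = ⊥-elim (Inner⇒¬branch (lt , e , i , h0 , hl , refl) u0 a)
  inner-neighbours⁺ u v lt e i y h0 hl (inj₂ (inj₂ (a , _))) = ⊥-elim (Inner⇒¬branch (lt , e , i , h0 , hl , refl) v0 a)

  suc[l∸i]≡l∸pred[i] : ∀ l i → 0 < i → i ≤ l → suc (l ∸ i) ≡ l ∸ pred i
  suc[l∸i]≡l∸pred[i] l (suc i) h0 h = sym (+-∸-assoc 1 h)

  inner-neighbours⁺-reversed : ∀ u v lt e i y → 0 < i → i < ℓ (path u v lt e) →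
    EdgeH⁺ (at (path u v lt e) (ℓ (path u v lt e) ∸ i)) y →
    y ≡ at (path u v lt e) (ℓ (path u v lt e) ∸ pred i) ⊎ y ≡ at (path u v lt e) (ℓ (path u v lt e) ∸ suc i)
  inner-neighbours⁺-reversed u v lt e i y h0 hl r with inner-neighbours⁺ u v lt e (l ∸ i) y (m<n⇒0<n∸m hl) (∸-monoʳ-< h0 (<⇒≤ hl)) r
    where l = ℓ (path u v lt e)
  ... | inj₁ a = inj₂ (trans a (cong (at (path u v lt e)) (pred[m∸n]≡m∸[1+n] (ℓ (path u v lt e)) i)))
  ... | inj₂ a = inj₁ (trans a (cong (at (path u v lt e)) (suc[l∸i]≡l∸pred[i] (ℓ (path u v lt e)) i h0 (<⇒≤ hl))))

  module Follow (q : ℕ → VH) (l : ℕ)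
    (nb : ∀ i y → 0 < i → i < l → EdgeH⁺ (q i) y → y ≡ q (pred i) ⊎ y ≡ q (suc i)) where

    follow-pair : ∀ s i → w s ≡ q i → w (suc s) ≡ q (suc i) → ∀ d → i + suc d ≤ l →
      w (s + d) ≡ q (i + d) × w (s + suc d) ≡ q (i + suc d)
    follow-pair s i a b zero h rewrite +-suc s 0 | +-suc i 0 | +-identityʳ s | +-identityʳ i = a , b
    follow-pair s i a b (suc d) h with follow-pair s i a b d (≤-trans (+-monoʳ-≤ i (n≤1+n (suc d))) h)
    ... | A , B = B , C
      where
      j = s + suc d
      k = i + suc d
      k>0 : 0 < k
      k>0 = subst (0 <_) (sym (+-suc i d)) (s≤s z≤n)
      k<l : k < l
      k<l = subst (_≤ l) (+-suc i (suc d)) h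
      r : EdgeH⁺ (q k) (w (suc j))
      r = subst (λ z → EdgeH⁺ z (w (suc j))) B (w-step j)
      pk : pred k ≡ i + d
      pk = cong pred (+-suc i d)
      C : w (s + suc (suc d)) ≡ q (i + suc (suc d))
      C with nb k (w (suc j)) k>0 k<l r
      ... | inj₁ x = ⊥-elim (no-backtrack (s + d) (trans (cong (λ z → w (suc z)) (sym (+-suc s d))) (trans x (trans (cong q pk) (sym A)))))
      ... | inj₂ x = trans (cong w (+-suc s (suc d))) (trans x (cong q (sym (+-suc i (suc d)))))

    follow : ∀ s i → w s ≡ q i → w (suc s) ≡ q (suc i) → ∀ d → i + d ≤ l → w (s + d) ≡ q (i + d)
    follow s i a b zero h rewrite +-identityʳ s | +-identityʳ i = a
    follow s i a b (suc d) h = proj₂ (follow-pair s i a b d h)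

  open Follow

  Branch : ℕ → Set
  Branch t = Σ VG λ z → φ z ≡ w t

  NoBranchBetween : ℕ → ℕ → Set
  NoBranchBetween s s' = ∀ t → s < t → t < s' → ¬ Branch t

  PathSegment : ℕ → ℕ → Set
  PathSegment s s' = Σ VG λ u → Σ VG λ v → Σ (toℕ u < toℕ v) λ lt → Σ (Edge G u v) λ e →
    s' ≡ s + ℓ (path u v lt e) ×
    ((w s ≡ φ u × w s' ≡ φ v × (∀ d → d ≤ ℓ (path u v lt e) → w (s + d) ≡ at (path u v lt e) d)) ⊎
     (w s ≡ φ v × w s' ≡ φ u ×
       (∀ d → d ≤ ℓ (path u v lt e) → w (s + d) ≡ at (path u v lt e) (ℓ (path u v lt e) ∸ d))))

  Segment : ℕ → ℕ → Set
  Segment s s' = (s' ≡ suc s × Unordered≡ (w s) (w s') (φ u0) (φ v0)) ⊎ PathSegment s s'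

  split-index : ∀ s t l → s < t → t < s + l → Σ ℕ λ d → t ≡ s + d × 0 < d × d < l
  split-index s t l st tl = t ∸ s , sym (m+[n∸m]≡n (<⇒≤ st)) , m<n⇒0<n∸m st ,
    subst (t ∸ s <_) (m+n∸m≡n s l) (∸-monoˡ-< tl (<⇒≤ st))

  forward-no-branch : ∀ s u v lt e → (∀ d → d ≤ ℓ (path u v lt e) → w (s + d) ≡ at (path u v lt e) d) →
    NoBranchBetween s (s + ℓ (path u v lt e))
  forward-no-branch s u v lt e fw t st tl (z , zt) with split-index s t _ st tl
  ... | d , refl , d0 , dl = Inner⇒¬branch (lt , e , d , d0 , dl , refl) z (trans (sym (fw d (<⇒≤ dl))) (sym zt))

  backward-no-branch : ∀ s u v lt e → (∀ d → d ≤ ℓ (path u v lt e) → w (s + d) ≡ at (path u v lt e) (ℓ (path u v lt e) ∸ d)) →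
    NoBranchBetween s (s + ℓ (path u v lt e))
  backward-no-branch s u v lt e bw t st tl (z , zt) with split-index s t _ st tl
  ... | d , refl , d0 , dl = Inner⇒¬branch (lt , e , ℓ (path u v lt e) ∸ d , m<n⇒0<n∸m dl , ∸-monoʳ-< d0 (<⇒≤ dl) , refl) z
          (trans (sym (bw d (<⇒≤ dl))) (sym zt))

  adjacent-no-branch : ∀ s → NoBranchBetween s (suc s)
  adjacent-no-branch s t st tl b = <-irrefl refl (≤-trans tl st)

  next-segment : ∀ s → Branch s → Σ ℕ λ s' → s < s' × Branch s' × NoBranchBetween s s' × Segment s s'
  next-segment s (z , zs) with w-step s
  ... | inj₂ (inj₁ (a , b)) = suc s , ≤-refl , (v0 , sym b) , adjacent-no-branch s , inj₁ (refl , inj₁ (a , b))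
  ... | inj₂ (inj₂ (a , b)) = suc s , ≤-refl , (u0 , sym b) , adjacent-no-branch s , inj₁ (refl , inj₂ (a , b))
  ... | inj₁ E with edge⇒PathStep _ _ E
  ...   | u , v , lt , e , i , hb , inj₁ (x1 , x2) with branch-position u v lt e i z (≤-trans (n≤1+n i) hb) (trans x1 (sym zs))
  ...     | inj₂ (eq , _) = ⊥-elim (<-irrefl eq hb)
  ...     | inj₁ (refl , _) =
            s + l , m<m+n s (ℓ≥1 P) , (v , sym wl) , forward-no-branch s u v lt e fw ,
            inj₂ (u , v , lt , e , refl , inj₁ (trans (sym x1) (at-start P) , wl , fw))
    where
    P = path u v lt e
    l = ℓ P
    fw : ∀ d → d ≤ l → w (s + d) ≡ at P d
    fw d h = follow (at P) l (inner-neighbours⁺ u v lt e) s 0 (sym x1) (sym x2) d h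
    wl : w (s + l) ≡ φ v
    wl = trans (fw l ≤-refl) (at-end P)
  next-segment s (z , zs) | inj₁ E | u , v , lt , e , i , hb , inj₂ (x1 , x2) with branch-position u v lt e (suc i) z hb (trans x2 (sym zs))
  ...     | inj₁ (() , _)
  ...     | inj₂ (eq , _) =
            s + l , m<m+n s (ℓ≥1 P) , (u , sym wl) , backward-no-branch s u v lt e bw ,
            inj₂ (u , v , lt , e , refl , inj₂ (ws , wl , bw))
    where
    P = path u v lt e
    l = ℓ P
    q : ℕ → VH
    q d = at P (l ∸ d)
    ws : w s ≡ φ v
    ws = trans (sym x2) (trans (cong (at P) eq) (at-end P))
    ws0 : w s ≡ q 0
    ws0 = trans (sym x2) (cong (at P) eq)
    bw : ∀ d → d ≤ l → w (s + d) ≡ q d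
    bw d h = follow q l (inner-neighbours⁺-reversed u v lt e) s 0 ws0
      (trans (sym x1) (cong (at P) (trans (cong pred eq) (pred[m∸n]≡m∸[1+n] l 0)))) d h
    wl : w (s + l) ≡ φ u
    wl = trans (bw l ≤-refl) (trans (cong (at P) (n∸n≡0 l)) (at-start P))

  branch-from-path-index : ∀ u v lt e k → k ≤ ℓ (path u v lt e) → at (path u v lt e) k ≡ w 0 → Σ ℕ Branch
  branch-from-path-index u v lt e k h eq with position (ℓ (path u v lt e)) k h
  ... | start refl = 0 , u , trans (sym (at-start (path u v lt e))) eq
  ... | end refl = 0 , v , trans (sym (at-end (path u v lt e))) eq
  ... | inner a b with inner-neighbours⁺ u v lt e k (w 1) a b (subst (λ x → EdgeH⁺ x (w 1)) (sym eq) (w-step 0))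
  ...   | inj₂ nx = (l ∸ k) , v , sym (trans fw (trans (cong (at P) (m+[n∸m]≡n h)) (at-end P)))
    where
    P = path u v lt e
    l = ℓ P
    fw : w (0 + (l ∸ k)) ≡ at P (k + (l ∸ k))
    fw = follow (at P) l (inner-neighbours⁺ u v lt e) 0 k (sym eq) nx (l ∸ k) (≤-reflexive (m+[n∸m]≡n h))
  ...   | inj₁ px = k , u , sym (trans bw (trans (cong (at P) (trans (cong (l ∸_) (m∸n+n≡m h)) (n∸n≡0 l))) (at-start P)))
    where
    P = path u v lt e
    l = ℓ P
    q : ℕ → VH
    q d = at P (l ∸ d)
    a0 : w 0 ≡ q (l ∸ k)
    a0 = trans (sym eq) (cong (at P) (sym (m∸[m∸n]≡n h)))
    a1 : w 1 ≡ q (suc (l ∸ k))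
    a1 = trans px (cong (at P) (trans (cong pred (sym (m∸[m∸n]≡n h))) (pred[m∸n]≡m∸[1+n] l (l ∸ k))))
    bw : w (0 + k) ≡ q ((l ∸ k) + k)
    bw = follow q l (inner-neighbours⁺-reversed u v lt e) 0 (l ∸ k) a0 a1 k (≤-reflexive (m∸n+n≡m h))

  some-branch : Σ ℕ Branch
  some-branch with covers-vertices (w 0)
  ... | inj₁ (z , e) = 0 , z , e
  ... | inj₂ (u , v , lt , e , i , eq) =
    branch-from-path-index u v lt e (toℕ i) (s≤s⁻¹ (toℕ<n i)) (trans (at-toℕ (path u v lt e) i) eq)

  branchOf : VH → VG
  branchOf x with any? (λ z → φ z Fin.≟ x)
  ... | yes (z , _) = z
  ... | no _ = u0

  branchOf-φ : ∀ z x → φ z ≡ x → branchOf x ≡ z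
  branchOf-φ z x e with any? (λ z → φ z Fin.≟ x)
  ... | yes (z' , e') = φ-inj (trans e' (sym e))
  ... | no ne = ⊥-elim (ne (z , e))

  branchAt : ℕ → VG
  branchAt t = branchOf (w t)

  branchAt-spec : ∀ t → (b : Branch t) → branchAt t ≡ proj₁ b
  branchAt-spec t (z , e) = branchOf-φ z (w t) e

  EdgeG⁺-irrefl : ∀ z → ¬ EdgeG⁺ z z
  EdgeG⁺-irrefl z (inj₁ e) = Edge-irrefl {G} e
  EdgeG⁺-irrefl z (inj₂ (inj₁ (a , b))) = uv (trans (sym a) b)
  EdgeG⁺-irrefl z (inj₂ (inj₂ (a , b))) = uv (trans (sym b) a)

  segment-edge′ : ∀ s s' z z' → φ z ≡ w s → φ z' ≡ w s' → Segment s s' → EdgeG⁺ z z'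
  segment-edge′ s s' z z' zs zs' (inj₁ (_ , inj₁ (a , b))) =
    inj₂ (inj₁ (φ-inj (trans zs a) , φ-inj (trans zs' b)))
  segment-edge′ s s' z z' zs zs' (inj₁ (_ , inj₂ (a , b))) =
    inj₂ (inj₂ (φ-inj (trans zs a) , φ-inj (trans zs' b)))
  segment-edge′ s s' z z' zs zs' (inj₂ (u , v , lt , e , _ , inj₁ (a , b , _)))
    rewrite φ-inj (trans zs a) | φ-inj (trans zs' b) = inj₁ e
  segment-edge′ s s' z z' zs zs' (inj₂ (u , v , lt , e , _ , inj₂ (a , b , _)))
    rewrite φ-inj (trans zs a) | φ-inj (trans zs' b) = inj₁ (Edge-sym {G} e)

  segment-edge : ∀ s s' → Branch s → Branch s' → Segment s s' → EdgeG⁺ (branchAt s) (branchAt s')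
  segment-edge s s' (z , zs) (z' , zs') si rewrite branchAt-spec s (z , zs) | branchAt-spec s' (z' , zs') =
    segment-edge′ s s' z z' zs zs' si

  new-edge-on-path : ∀ a b u v → Unordered≡ a b (φ u0) (φ v0) → Unordered≡ b a (φ u) (φ v) → Edge G u v → ⊥
  new-edge-on-path a b u v (inj₁ (a0 , b0)) (inj₁ (bu , av)) e =
    nadj (subst₂ (Edge G) (sym (φ-inj (trans (sym a0) av))) (sym (φ-inj (trans (sym b0) bu))) (Edge-sym {G} e))
  new-edge-on-path a b u v (inj₁ (a0 , b0)) (inj₂ (bv , au)) e =
    nadj (subst₂ (Edge G) (sym (φ-inj (trans (sym a0) au))) (sym (φ-inj (trans (sym b0) bv))) e)
  new-edge-on-path a b u v (inj₂ (a0 , b0)) (inj₁ (bu , av)) e =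
    nadj (subst₂ (Edge G) (sym (φ-inj (trans (sym b0) bu))) (sym (φ-inj (trans (sym a0) av))) e)
  new-edge-on-path a b u v (inj₂ (a0 , b0)) (inj₂ (bv , au)) e =
    nadj (subst₂ (Edge G) (sym (φ-inj (trans (sym b0) bv))) (sym (φ-inj (trans (sym a0) au))) (Edge-sym {G} e))

  window-bounds′ : ∀ b0 l → 3 ≤ l + l →
    (b0 + 1 < (b0 + l) + (l ∸ 1)) × ((b0 + l) + (l ∸ 1) < (b0 + 1) + (l + l))
  window-bounds′ b0 zero ()
  window-bounds′ b0 (suc zero) (s≤s (s≤s ()))
  window-bounds′ b0 (suc (suc m)) h
    rewrite +-assoc b0 (suc (suc m)) (suc m) | +-assoc b0 1 (suc (suc m) + suc (suc m)) =
    +-monoʳ-< b0 (s≤s (s≤s z≤n)) ,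
    +-monoʳ-< b0 (s≤s (s≤s (s≤s (+-monoʳ-≤ m (n≤1+n (suc m))))))

  window-bounds : ∀ b0 l → b0 + L ≡ (b0 + l) + l →
    (b0 + 1 < (b0 + l) + (l ∸ 1)) × ((b0 + l) + (l ∸ 1) < (b0 + 1) + L)
  window-bounds b0 l eq = proj₁ r , subst (λ z → (b0 + l) + (l ∸ 1) < (b0 + 1) + z) (sym Lq) (proj₂ r)
    where
    Lq : L ≡ l + l
    Lq = +-cancelˡ-≡ b0 L (l + l) (trans eq (+-assoc b0 l l))
    r = window-bounds′ b0 l (subst (3 ≤_) Lq L≥3)

  two-paths-collide : ∀ b0 b1 l → b1 ≡ b0 + l → b0 + L ≡ b1 + l → w (b0 + 1) ≡ w (b1 + (l ∸ 1)) → ⊥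
  two-paths-collide b0 b1 l refl eB eqw = w-injective (b0 + 1) ((b0 + l) + (l ∸ 1)) (proj₁ ar) (proj₂ ar) eqw
    where ar = window-bounds b0 l eB

  no-two-path-segment-cycle : ∀ b0 b1 → PathSegment b0 b1 → PathSegment b1 (b0 + L) → ⊥
  no-two-path-segment-cycle b0 b1 (u , v , lt , e , _ , inj₁ (x0 , x1 , _)) (u' , v' , lt' , e' , _ , inj₁ (y1 , yB , _)) =
    ¬swapped< (φ-inj (trans (sym x0) (trans (sym (w-periodic b0)) yB))) (φ-inj (trans (sym x1) y1)) lt lt'
  no-two-path-segment-cycle b0 b1 (u , v , lt , e , _ , inj₂ (x0 , x1 , _)) (u' , v' , lt' , e' , _ , inj₂ (y1 , yB , _)) =
    ¬swapped< (φ-inj (trans (sym x1) y1)) (φ-inj (trans (sym x0) (trans (sym (w-periodic b0)) yB))) lt lt'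
  no-two-path-segment-cycle b0 b1 (u , v , lt , e , b1≡ , inj₁ (x0 , x1 , fwd)) (u' , v' , _ , _ , B≡ , inj₂ (y0 , yB , bwd))
    with φ-inj (trans (sym (trans (sym (w-periodic b0)) yB)) x0) | φ-inj (trans (sym y0) x1)
  ... | refl | refl = two-paths-collide b0 b1 (ℓ P) b1≡ B≡
        (trans (fwd 1 (ℓ≥1 P)) (sym (trans (bwd (ℓ P ∸ 1) (m∸n≤m (ℓ P) 1)) (cong (at P) (m∸[m∸n]≡n (ℓ≥1 P))))))
    where P = path u v lt e
  no-two-path-segment-cycle b0 b1 (u , v , lt , e , b1≡ , inj₂ (x0 , x1 , bwd)) (u' , v' , _ , _ , B≡ , inj₁ (y0 , yB , fwd))
    with φ-inj (trans (sym y0) x1) | φ-inj (trans (sym (trans (sym (w-periodic b0)) yB)) x0)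
  ... | refl | refl = two-paths-collide b0 b1 (ℓ P) b1≡ B≡
        (trans (bwd 1 (ℓ≥1 P)) (sym (fwd (ℓ P ∸ 1) (m∸n≤m (ℓ P) 1))))
    where P = path u v lt e

  no-two-segment-cycle : ∀ b0 b1 → Segment b0 b1 → Segment b1 (b0 + L) → ⊥
  no-two-segment-cycle b0 b1 (inj₁ (e1 , _)) (inj₁ (e2 , _)) with subst (3 ≤_) (+-cancelˡ-≡ b0 L 2 (trans e2 (trans (cong suc e1) (+-comm 2 b0)))) L≥3
  ... | s≤s (s≤s ())
  no-two-segment-cycle b0 b1 (inj₁ (_ , N)) (inj₂ (u , v , lt , e , _ , inj₁ (x1 , xB , _))) =
    new-edge-on-path (w b0) (w b1) u v N (inj₁ (x1 , trans (sym (w-periodic b0)) xB)) e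
  no-two-segment-cycle b0 b1 (inj₁ (_ , N)) (inj₂ (u , v , lt , e , _ , inj₂ (x1 , xB , _))) =
    new-edge-on-path (w b0) (w b1) u v N (inj₂ (x1 , trans (sym (w-periodic b0)) xB)) e
  no-two-segment-cycle b0 b1 (inj₂ (u , v , lt , e , _ , inj₁ (x0 , x1 , _))) (inj₁ (_ , N)) =
    new-edge-on-path (w b1) (w b0) u v (subst (λ x → Unordered≡ (w b1) x (φ u0) (φ v0)) (w-periodic b0) N) (inj₁ (x0 , x1)) e
  no-two-segment-cycle b0 b1 (inj₂ (u , v , lt , e , _ , inj₂ (x0 , x1 , _))) (inj₁ (_ , N)) =
    new-edge-on-path (w b1) (w b0) u v (subst (λ x → Unordered≡ (w b1) x (φ u0) (φ v0)) (w-periodic b0) N) (inj₂ (x0 , x1)) e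
  no-two-segment-cycle b0 b1 (inj₂ P) (inj₂ P') = no-two-path-segment-cycle b0 b1 P P'

  module Project (b0 : ℕ) (br0 : Branch b0) where

    B : ℕ
    B = b0 + L

    brB : Branch B
    brB = proj₁ br0 , trans (proj₂ br0) (sym (w-periodic b0))

    zB : branchAt B ≡ branchAt b0
    zB = cong branchOf (w-periodic b0)

    segment-within-period : ∀ s s' → s < B → NoBranchBetween s s' → s' ≤ B
    segment-within-period s s' sB nob with s' ≤? B
    ... | yes h = h
    ... | no h = ⊥-elim (nob B sB (≰⇒> h) brB)

    InWindow : ℕ → Set
    InWindow t = b0 ≤ t × t < B × Branch t

    collect-segments : ∀ f s → B ≤ s + f → Branch s → b0 ≤ s → s < B →
      Σ (List ℕ) λ ts → Chain EdgeG⁺ (map branchAt (s ∷ ts)) (branchAt b0) ×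
        All (λ t → s < t × InWindow t) ts × AllPairs _<_ ts
    collect-segments zero s h br bs sB = ⊥-elim (<-irrefl refl (≤-trans sB (subst (B ≤_) (+-identityʳ s) h)))
    collect-segments (suc f) s h br bs sB with next-segment s br
    ... | s' , ss' , br' , nob , seg with m≤n⇒m<n∨m≡n (segment-within-period s s' sB nob)
    ...   | inj₂ eq = [] , [ subst (EdgeG⁺ (branchAt s)) (trans (cong branchAt eq) zB) (segment-edge s s' br br' seg) ] , [] , []
    ...   | inj₁ lt' with collect-segments f s' (≤-trans h (≤-trans (≤-reflexive (+-suc s f)) (+-monoˡ-≤ f ss'))) br' (≤-trans bs (<⇒≤ ss')) lt'
    ...     | ts , ch , al , ap =
      s' ∷ ts , segment-edge s s' br br' seg ∷ ch ,
      (ss' , ≤-trans bs (<⇒≤ ss') , lt' , br') ∷ All.map (λ { (a , b) → <-trans ss' a , b }) al ,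
      All.map proj₁ al ∷ ap

    window-injective : ∀ a b → InWindow a → InWindow b → w a ≡ w b → a ≡ b
    window-injective a b (ba , aB , _) (bb , bB , _) eq with <-cmp a b
    ... | tri< a<b _ _ = ⊥-elim (w-injective a b a<b (<-≤-trans bB (+-monoˡ-≤ L ba)) eq)
    ... | tri≈ _ e _ = e
    ... | tri> _ _ b<a = ⊥-elim (w-injective b a b<a (<-≤-trans aB (+-monoˡ-≤ L bb)) (sym eq))

    branchAt-injective : ∀ {a b} → InWindow a → InWindow b → branchAt a ≡ branchAt b → a ≡ b
    branchAt-injective {a} {b} ia ib eq = window-injective a b ia ib
      (trans (sym (proj₂ (proj₂ (proj₂ ia))))
        (trans (cong φ (trans (sym (branchAt-spec a (proj₂ (proj₂ ia)))) (trans eq (branchAt-spec b (proj₂ (proj₂ ib))))))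
          (proj₂ (proj₂ (proj₂ ib)))))

    b0<B : b0 < B
    b0<B = m<m+n b0 (≤-trans (s≤s z≤n) L≥3)

    OnWalk : VG → Set
    OnWalk z = Σ ℕ λ t → φ z ≡ w t

    project : Σ VG λ x → Σ (List VG) λ xs → 3 ≤ length (x ∷ xs) × Unique (x ∷ xs) ×
      Chain EdgeG⁺ (x ∷ xs) x × All OnWalk (x ∷ xs)
    project with next-segment b0 br0
    ... | b1 , b01 , br1 , nob1 , seg1 with m≤n⇒m<n∨m≡n (segment-within-period b0 b1 b0<B nob1)
    ...   | inj₂ eq = ⊥-elim (EdgeG⁺-irrefl (branchAt b0) (subst (EdgeG⁺ (branchAt b0)) (trans (cong branchAt eq) zB) (segment-edge b0 b1 br0 br1 seg1)))
    ...   | inj₁ b1B with next-segment b1 br1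
    ...     | b2 , b12 , br2 , nob2 , seg2 with m≤n⇒m<n∨m≡n (segment-within-period b1 b2 b1B nob2)
    ...       | inj₂ eq = ⊥-elim (no-two-segment-cycle b0 b1 seg1 (subst (Segment b1) eq seg2))
    ...       | inj₁ b2B with collect-segments B b2 (m≤n+m B b2) br2 (<⇒≤ (<-trans b01 b12)) b2B
    ...         | ts , ch , al , ap =
      branchAt b0 , branchAt b1 ∷ branchAt b2 ∷ map branchAt ts , s≤s (s≤s (s≤s z≤n)) ,
      Unique-map⁺ branchAt InWindow allW branchAt-injective (AllPairs.map <⇒≢ apos) ,
      segment-edge b0 b1 br0 br1 seg1 ∷ segment-edge b1 b2 br1 br2 seg2 ∷ ch ,
      All.map⁺ (All.map toG allW)
      where
      b02 = <-trans b01 b12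
      allW : All InWindow (b0 ∷ b1 ∷ b2 ∷ ts)
      allW = (≤-refl , b0<B , br0) ∷ (<⇒≤ b01 , b1B , br1) ∷ (<⇒≤ b02 , b2B , br2) ∷ All.map proj₂ al
      apos : AllPairs _<_ (b0 ∷ b1 ∷ b2 ∷ ts)
      apos = (b01 ∷ b02 ∷ All.map (λ x → <-trans b02 (proj₁ x)) al) ∷
             (b12 ∷ All.map (λ x → <-trans b12 (proj₁ x)) al) ∷
             All.map proj₁ al ∷ ap
      toG : ∀ {t} → InWindow t → OnWalk (branchAt t)
      toG {t} (_ , _ , br) = t , trans (cong φ (branchAt-spec t br)) (proj₂ br)


module ProjectingCycles (G H : Graph) (S : SubdivisionOf H G) where
  open Subdivision G H S

  module ProjectCycle (u0 v0 : VG) (uv : u0 ≢ v0) (nadj : ¬ Edge G u0 v0)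
    (C : Cycle (EdgePlus H (φ u0) (φ v0))) where
    open CycleWalk C
    module W = ProjectWalk G H S u0 v0 uv nadj w w-step L (len≥3 C) w-periodic w-injective

    projectCycle : Σ (Cycle (EdgePlus G u0 v0)) λ D → ∀ i → Σ (Fin (len C)) λ j → φ (vs D i) ≡ vs C j
    projectCycle with W.some-branch
    ... | b0 , br0 with W.Project.project b0 br0
    ... | x , xs , l3 , u , ch , al = Chain⇒Cycle x xs l3 u ch , λ i → f (All.lookup al (∈-lookup i))
      where
      f : ∀ {z} → W.Project.OnWalk b0 br0 z → Σ (Fin (len C)) λ j → φ z ≡ vs C j
      f (t , e) = wrap t , e

  project-disjoint-cycles : ∀ k u v → u ≢ v → ¬ Edge G u v → HasDisjointCycles (EdgePlus H (φ u) (φ v)) k →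
    HasDisjointCycles (EdgePlus G u v) k
  project-disjoint-cycles k u v uv ne (cs , dj) = (λ a → proj₁ (P a)) , λ a b ab i j eq →
    dj a b ab (proj₁ (proj₂ (P a) i)) (proj₁ (proj₂ (P b) j))
      (trans (sym (proj₂ (proj₂ (P a) i))) (trans (cong φ eq) (proj₂ (proj₂ (P b) j))))
    where
    P : ∀ a → Σ (Cycle (EdgePlus G u v)) λ D → ∀ i → Σ (Fin (len (cs a))) λ j → φ (vs D i) ≡ vs (cs a) j
    P a = ProjectCycle.projectCycle u v uv ne (cs a)


module Lifting (G H : Graph) (S : SubdivisionOf H G) where
  open Subdivision G H S

  InnerOf : VG → VG → VH → Set
  InnerOf a b x = Inner a b x ⊎ Inner b a x

  InnerOf⇒¬branch : ∀ {a b x} → InnerOf a b x → ∀ w → x ≢ φ w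
  InnerOf⇒¬branch (inj₁ i) = Inner⇒¬branch i
  InnerOf⇒¬branch (inj₂ i) = Inner⇒¬branch i

  InnerOf-unique : ∀ {a b c d x} → InnerOf a b x → InnerOf c d x → Unordered≡ a b c d
  InnerOf-unique (inj₁ i) (inj₁ j) = inj₁ (Inner-unique i j)
  InnerOf-unique (inj₁ i) (inj₂ j) = inj₂ (Inner-unique i j)
  InnerOf-unique (inj₂ i) (inj₁ j) = inj₂ (swap (Inner-unique i j))
  InnerOf-unique (inj₂ i) (inj₂ j) = inj₁ (swap (Inner-unique i j))

  record BranchPath (a b : VG) : Set where
    field
      steps : ℕ
      steps≥1 : 1 ≤ steps
      vertex : ℕ → VH
      vertex-start : vertex 0 ≡ φ a
      vertex-end : vertex steps ≡ φ b
      vertex-edge : ∀ d → d < steps → Edge H (vertex d) (vertex (suc d))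
      vertex-injective : ∀ i j → i ≤ steps → j ≤ steps → vertex i ≡ vertex j → i ≡ j
      vertex-inner : ∀ d → 0 < d → d < steps → InnerOf a b (vertex d)
  open BranchPath

  forwardPath : ∀ a b → (lt : toℕ a < toℕ b) → (e : Edge G a b) → BranchPath a b
  forwardPath a b lt e = record
    { steps = ℓ P ; steps≥1 = ℓ≥1 P ; vertex = at P ; vertex-start = at-start P ; vertex-end = at-end P
    ; vertex-edge = at-edge P ; vertex-injective = at-injective P
    ; vertex-inner = λ d d0 steps → inj₁ (lt , e , d , d0 , steps , refl) }
    where P = path a b lt e

  backwardPath : ∀ a b → (gt : toℕ b < toℕ a) → (e : Edge G b a) → BranchPath a b
  backwardPath a b gt e = record
    { steps = l ; steps≥1 = ℓ≥1 P ; vertex = λ d → at P (l ∸ d) ; vertex-start = at-end P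
    ; vertex-end = trans (cong (at P) (n∸n≡0 l)) (at-start P)
    ; vertex-edge = reversed-edge
    ; vertex-injective = λ i j hi hj eq → trans (sym (m∸[m∸n]≡n hi))
        (trans (cong (l ∸_) (at-injective P (l ∸ i) (l ∸ j) (m∸n≤m l i) (m∸n≤m l j) eq)) (m∸[m∸n]≡n hj))
    ; vertex-inner = λ d d0 steps → inj₂ (gt , e , l ∸ d , m<n⇒0<n∸m steps , ∸-monoʳ-< d0 (<⇒≤ steps) , refl) }
    where
    P = path b a gt e
    l = ℓ P
    reversed-edge : ∀ d → d < l → Edge H (at P (l ∸ d)) (at P (l ∸ suc d))
    reversed-edge d h = Edge-sym {H} (subst (λ z → Edge H (at P (l ∸ suc d)) (at P z)) (sym (+-∸-assoc 1 h))
      (at-edge P (l ∸ suc d) (∸-monoʳ-< (s≤s z≤n) h)))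

  branchPath : ∀ a b → Edge G a b → BranchPath a b
  branchPath a b e with <-cmp (toℕ a) (toℕ b)
  ... | tri< lt _ _ = forwardPath a b lt e
  ... | tri≈ _ eq _ = ⊥-elim (Edge-irrefl {G} (subst (Edge G a) (sym (toℕ-injective eq)) e))
  ... | tri> _ _ gt = backwardPath a b gt (Edge-sym {G} e)

  pathPrefix : ∀ {a b} → BranchPath a b → List VH
  pathPrefix D = map (vertex D) (range 0 (suc (pred (steps D))))

  suc-pred-steps : ∀ {a b} (D : BranchPath a b) → suc (pred (steps D)) ≡ steps D
  suc-pred-steps D = suc-pred (steps D) {{>-nonZero (steps≥1 D)}}

  pathPrefix-chain : ∀ {a b} (D : BranchPath a b) → Chain (Edge H) (pathPrefix D) (φ b)
  pathPrefix-chain {a} {b} D = subst (Chain (Edge H) (pathPrefix D)) (trans (cong (vertex D) (suc-pred-steps D)) (vertex-end D))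
    (Chain-map-range (vertex D) 0 (pred (steps D)) (λ t _ h → vertex-edge D t (subst (t <_) (suc-pred-steps D) h)))

  pathPrefix-unique : ∀ {a b} (D : BranchPath a b) → Unique (pathPrefix D)
  pathPrefix-unique D = Unique-map⁺ (vertex D) (λ t → t < steps D)
    (All.map (λ xy → subst (_ <_) (suc-pred-steps D) (proj₂ xy)) (range-bounds 0 (suc (pred (steps D)))))
    (λ {i} {j} hi hj eq → vertex-injective D i j (<⇒≤ hi) (<⇒≤ hj) eq) (range-unique 0 _)

  pathPrefix-member : ∀ {a b x} (D : BranchPath a b) → x ∈ pathPrefix D → x ≡ φ a ⊎ InnerOf a b x
  pathPrefix-member D m with ∈-map⁻ (vertex D) m
  ... | zero , _ , refl = inj₁ (vertex-start D)
  ... | suc t , tm , refl = inj₂ (vertex-inner D (suc t) (s≤s z≤n)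
          (subst (suc t <_) (suc-pred-steps D) (proj₂ (All.lookup (range-bounds 0 (suc (pred (steps D)))) tm))))

  pathInterior : ∀ {a b} → BranchPath a b → List VH
  pathInterior D = map (vertex D) (range 1 (pred (steps D)))

  subdivide : ∀ {zs b} → Chain (Edge G) zs b → List VH
  subdivide ([_] {x} {b} e) = pathPrefix (branchPath x b e)
  subdivide (_∷_ {x} {y} e ch) = pathPrefix (branchPath x y e) ++ subdivide ch

  subdivide-head : ∀ {z zs b} (ch : Chain (Edge G) (z ∷ zs) b) → Σ (List VH) λ r → subdivide ch ≡ φ z ∷ r
  subdivide-head ([_] {x} {b} e) = pathInterior (branchPath x b e) , cong (_∷ pathInterior (branchPath x b e)) (vertex-start (branchPath x b e))
  subdivide-head (_∷_ {x} {y} e ch) = pathInterior (branchPath x y e) ++ subdivide ch , cong (_∷ (pathInterior (branchPath x y e) ++ subdivide ch)) (vertex-start (branchPath x y e))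

  subdivide-chain : ∀ {zs b} (ch : Chain (Edge G) zs b) → Chain (Edge H) (subdivide ch) (φ b)
  subdivide-chain ([_] {x} {b} e) = pathPrefix-chain (branchPath x b e)
  subdivide-chain (_∷_ {x} {y} e ch) with subdivide-head ch | subdivide-chain ch
  ... | r , eq | c2 rewrite eq = Chain-++ (pathPrefix-chain (branchPath x y e)) c2

  length-subdivide : ∀ {zs b} (ch : Chain (Edge G) zs b) → length zs ≤ length (subdivide ch)
  length-subdivide ([_] {x} {b} e) = s≤s z≤n
  length-subdivide (_∷_ {x} {y} e ch) = s≤s (≤-trans (length-subdivide ch)
    (subst (length (subdivide ch) ≤_) (sym (length-++ (map (vertex (branchPath x y e)) (range 1 (pred (steps (branchPath x y e)))))))
      (m≤n+m (length (subdivide ch)) _)))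

  SubdivideMember : VG → List VG → VG → VH → Set
  SubdivideMember y ys b x = (Σ VG λ z → z ∈ (y ∷ ys) × x ≡ φ z) ⊎
    (Σ VG λ z → Σ VG λ z' → InnerOf z z' x ×
       ((z ∈ (y ∷ ys) × z' ∈ ys) ⊎ (z' ≡ b × ((ys ≡ [] × z ≡ y) ⊎ z ∈ ys))))

  subdivide-member : ∀ {y ys b x} (ch : Chain (Edge G) (y ∷ ys) b) → x ∈ subdivide ch → SubdivideMember y ys b x
  subdivide-member ([_] {y} {b} e) m with pathPrefix-member (branchPath y b e) m
  ... | inj₁ eq = inj₁ (y , here refl , eq)
  ... | inj₂ I = inj₂ (y , b , I , inj₂ (refl , inj₁ (refl , refl)))
  subdivide-member (_∷_ {y} {y2} {ys2} e ch) m with ∈-++⁻ (pathPrefix (branchPath y y2 e)) m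
  ... | inj₁ m1 with pathPrefix-member (branchPath y y2 e) m1
  ...   | inj₁ eq = inj₁ (y , here refl , eq)
  ...   | inj₂ I = inj₂ (y , y2 , I , inj₁ (here refl , here refl))
  subdivide-member (_∷_ {y} {y2} {ys2} e ch) m | inj₂ m2 with subdivide-member ch m2
  ... | inj₁ (z , zm , eq) = inj₁ (z , there zm , eq)
  ... | inj₂ (z , z' , I , inj₁ (zm , z'm)) = inj₂ (z , z' , I , inj₁ (there zm , there z'm))
  ... | inj₂ (z , z' , I , inj₂ (zb , inj₁ (_ , refl))) = inj₂ (z , z' , I , inj₂ (zb , inj₂ (here refl)))
  ... | inj₂ (z , z' , I , inj₂ (zb , inj₂ zm)) = inj₂ (z , z' , I , inj₂ (zb , inj₂ (there zm)))

  subdivide-unique : ∀ {y ys b} (ch : Chain (Edge G) (y ∷ ys) b) → Unique (y ∷ ys) → b ∉ ys →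
    (b ≡ y → 3 ≤ length (y ∷ ys)) → Unique (subdivide ch)
  subdivide-unique ([_] {y} {b} e) u nb h3 = pathPrefix-unique (branchPath y b e)
  subdivide-unique (_∷_ {x} {y} {ys} e ch) (px ∷ u) nb h3 =
    Unique.++⁺ (pathPrefix-unique (branchPath x y e)) (subdivide-unique ch u (λ m → nb (there m)) (λ eq → ⊥-elim (nb (here eq)))) disj
    where
    x∉ : x ∉ y ∷ ys
    x∉ = head∉tail (px ∷ u)
    y∉ : y ∉ ys
    y∉ = head∉tail u
    disj : ∀ {v} → ¬ (v ∈ pathPrefix (branchPath x y e) × v ∈ subdivide ch)
    disj (m1 , m2) with pathPrefix-member (branchPath x y e) m1 | subdivide-member ch m2
    ... | inj₁ e1 | inj₁ (z , zm , e2) = x∉ (subst (_∈ (y ∷ ys)) (sym (φ-inj (trans (sym e1) e2))) zm)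
    ... | inj₁ e1 | inj₂ (z , z' , I , _) = InnerOf⇒¬branch I x e1
    ... | inj₂ I | inj₁ (z , zm , e2) = InnerOf⇒¬branch I z e2
    ... | inj₂ I | inj₂ (z , z' , J , c) with InnerOf-unique I J | c
    ...   | inj₁ (xz , _) | inj₁ (zm , _) = x∉ (subst (_∈ (y ∷ ys)) (sym xz) zm)
    ...   | inj₁ (xz , _) | inj₂ (_ , inj₁ (_ , zy)) = x∉ (here (trans xz zy))
    ...   | inj₁ (xz , _) | inj₂ (_ , inj₂ zm) = x∉ (there (subst (_∈ ys) (sym xz) zm))
    ...   | inj₂ (xz' , yz) | inj₁ (_ , z'm) = x∉ (there (subst (_∈ ys) (sym xz') z'm))
    ...   | inj₂ (xz' , yz) | inj₂ (z'b , inj₂ zm) = y∉ (subst (_∈ ys) (sym yz) zm)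
    ...   | inj₂ (xz' , yz) | inj₂ (z'b , inj₁ (refl , _)) with h3 (sym (trans xz' z'b))
    ...     | s≤s (s≤s ())

  LiftedVertex : ∀ {L} → (Fin L → VG) → VH → Set
  LiftedVertex {L} f x = Σ VG λ z → (Σ (Fin L) λ j → f j ≡ z) ×
    (x ≡ φ z ⊎ Σ VG λ z' → (Σ (Fin L) λ j → f j ≡ z') × InnerOf z z' x)

  module LiftCycle (C : Cycle (Edge G)) where
    open CycleWalk C

    c : ℕ
    c = pred L

    1+c≡L : suc c ≡ L
    1+c≡L = suc-pred L

    y : VG
    y = w 0

    ys : List VG
    ys = map w (range 1 c)

    cycle-chain : Chain (Edge G) (y ∷ ys) y
    cycle-chain = subst (Chain (Edge G) (y ∷ ys)) (trans (cong w 1+c≡L) (w-periodic 0))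
      (Chain-map-range w 0 c (λ t _ _ → w-step t))

    cycle-unique : Unique (y ∷ ys)
    cycle-unique = Unique-map⁺ w (_< L) (All.map (λ xy → subst (_ <_) 1+c≡L (proj₂ xy)) (range-bounds 0 (suc c)))
      w-injective-< (range-unique 0 (suc c))

    cycle-member : ∀ {z} → z ∈ (y ∷ ys) → Σ (Fin L) λ j → vs C j ≡ z
    cycle-member m with ∈-map⁻ w {xs = range 0 (suc c)} m
    ... | t , _ , refl = wrap t , refl

    cycle-length : 3 ≤ length (y ∷ ys)
    cycle-length = subst (3 ≤_) (sym (trans (length-map w (range 0 (suc c)))
      (trans (length-range 0 (suc c)) 1+c≡L))) (len≥3 C)

    lifted-head : Σ (List VH) λ r → subdivide cycle-chain ≡ φ y ∷ r
    lifted-head = subdivide-head cycle-chain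

    liftCycle : Σ (Cycle (Edge H)) λ D → ∀ i → LiftedVertex (vs C) (vs D i)
    liftCycle = Chain⇒Cycle (φ y) r lifted-length lifted-unique lifted-chain , λ i → lifted-vertex (subst (vs (Chain⇒Cycle (φ y) r lifted-length lifted-unique lifted-chain) i ∈_) (sym eq) (∈-lookup i))
      where
      r = proj₁ lifted-head
      eq = proj₂ lifted-head
      lifted-length : 3 ≤ length (φ y ∷ r)
      lifted-length = subst (λ z → 3 ≤ length z) eq (≤-trans cycle-length (length-subdivide cycle-chain))
      lifted-unique : Unique (φ y ∷ r)
      lifted-unique = subst Unique eq (subdivide-unique cycle-chain cycle-unique (head∉tail cycle-unique) (λ _ → cycle-length))
      lifted-chain : Chain (Edge H) (φ y ∷ r) (φ y)
      lifted-chain = subst (λ z → Chain (Edge H) z (φ y)) eq (subdivide-chain cycle-chain)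
      lifted-vertex : ∀ {x} → x ∈ subdivide cycle-chain → LiftedVertex (vs C) x
      lifted-vertex m with subdivide-member cycle-chain m
      ... | inj₁ (z , zm , e) = z , cycle-member zm , inj₁ e
      ... | inj₂ (z , z' , I , inj₁ (zm , z'm)) = z , cycle-member zm , inj₂ (z' , cycle-member (there z'm) , I)
      ... | inj₂ (z , z' , I , inj₂ (refl , inj₁ (_ , refl))) = z , cycle-member (here refl) , inj₂ (y , cycle-member (here refl) , I)
      ... | inj₂ (z , z' , I , inj₂ (refl , inj₂ zm)) = z , cycle-member (there zm) , inj₂ (y , cycle-member (here refl) , I)

  lift-disjoint-cycles : ∀ k → HasDisjointCycles (Edge G) k → HasDisjointCycles (Edge H) k
  lift-disjoint-cycles k (cs , dj) = (λ a → proj₁ (P a)) , dis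
    where
    P : ∀ a → Σ (Cycle (Edge H)) λ D → ∀ i → LiftedVertex (vs (cs a)) (vs D i)
    P a = LiftCycle.liftCycle (cs a)
    dis : ∀ a b → a ≢ b → ∀ i j → vs (proj₁ (P a)) i ≢ vs (proj₁ (P b)) j
    dis a b ab i j eq with proj₂ (P a) i | proj₂ (P b) j
    ... | z1 , (j1 , e1) , inj₁ x1 | z2 , (j2 , e2) , inj₁ x2 =
          dj a b ab j1 j2 (trans e1 (trans (φ-inj (trans (sym x1) (trans eq x2))) (sym e2)))
    ... | z1 , _ , inj₁ x1 | z2 , _ , inj₂ (_ , _ , I) = InnerOf⇒¬branch I z1 (trans (sym eq) x1)
    ... | z1 , _ , inj₂ (_ , _ , I) | z2 , _ , inj₁ x2 = InnerOf⇒¬branch I z2 (trans eq x2)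
    ... | z1 , (j1 , e1) , inj₂ (z1' , (j1' , e1') , I) | z2 , (j2 , e2) , inj₂ (z2' , (j2' , e2') , J)
          with InnerOf-unique I (subst (InnerOf z2 z2') (sym eq) J)
    ...   | inj₁ (p , _) = dj a b ab j1 j2 (trans e1 (trans p (sym e2)))
    ...   | inj₂ (p , _) = dj a b ab j1 j2' (trans e1 (trans p (sym e2')))

m+n≡o+p⇒+p-+m≡+n-+o : ∀ m n o p → m + n ≡ o + p → + p - + m ≡ + n - + o
m+n≡o+p⇒+p-+m≡+n-+o m n o p eq = begin
  + p - + m              ≡⟨ m-n≡m⊖n p m ⟩
  p ⊖ m                  ≡⟨ +-cancelˡ-⊖ o p m ⟨
  (o + p) ⊖ (o + m)      ≡⟨ cong₂ _⊖_ eq (+-comm m o) ⟨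
  (m + n) ⊖ (m + o)      ≡⟨ +-cancelˡ-⊖ m n o ⟩
  n ⊖ o                  ≡⟨ m-n≡m⊖n n o ⟨
  + n - + o              ∎
  where open ≡-Reasoning

∣E∣-∣V∣-subdivision : (G H : Graph) → SubdivisionOf H G → + ∣E∣ H - + ∣V∣ H ≡ + ∣E∣ G - + ∣V∣ G
∣E∣-∣V∣-subdivision G H S = m+n≡o+p⇒+p-+m≡+n-+o (n H) (∣E∣ G) (n G) (∣E∣ H) (Counting.vertices+edges G H S)

Saturated-subdivision : (G H : Graph) → SubdivisionOf H G → ∀ k → Saturated k H → Saturated k G
Saturated-subdivision G H S k (H-free , H-saturated) =
  (λ cycles → H-free (Lifting.lift-disjoint-cycles G H S k cycles)) ,
  λ u v u≢v ¬uv → ProjectingCycles.project-disjoint-cycles G H S k u v u≢v ¬uv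
    (H-saturated (φ u) (φ v) (λ e → u≢v (φ-inj e)) (λ E → ¬uv (branch-edge u v E)))
  where open Subdivision G H S

lemma3p1 : (G H : Graph) → SubdivisionOf H G →
    ((+ ∣E∣ H) - (+ ∣V∣ H) ≡ (+ ∣E∣ G) - (+ ∣V∣ G)) ×
    (∀ (k : ℕ) → 2 ≤ k → Saturated k H → (G ≅ K (3 * k ∸ 1)) ⊎ Saturated k G)
lemma3p1 G H S = ∣E∣-∣V∣-subdivision G H S , λ k _ → inj₂ ∘ Saturated-subdivision G H S k
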